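{- Let $X,Y\subseteq\mathbb{N}$, let $\rho=(\rho_1,\dots,\rho_m)$ be a composition of $n$, and let $s\ge0$. Write $[m]\setminus X=\{v_1,\dots,v_b\}$ and $a=\sum_{i=1}^b\rho_{v_i}$. Then $$P_{\rho,s}^{X,Y}=\binom{a}{\rho_{v_1},\dots,\rho_{v_b}}\sum_{r=0}^{s}(-1)^{s-r}\binom{a+r}{r}\binom{n+1}{s-r}\prod_{x\in X\cap[m]}\binom{\rho_x+r+\alpha_{X,\rho,x}+\beta_{Y,\rho,x}}{\rho_x}.$$
   Context: A composition $\rho=(\rho_1,\dots,\rho_m)$ of $n$ has positive integer parts summing to $n$. $R(\rho)$ is the set of all words $w=w_1\cdots w_n$ that are rearrangements of $1^{\rho_1}2^{\rho_2}\cdots m^{\rho_m}$ ($\rho_i$ copies of $i$). For $X,Y\subseteq\mathbb{N}$, $des_{X,Y}(w)=|\{i:w_i>w_{i+1},\ w_i\in X,\ w_{i+1}\in Y\}|$ and $P_{\rho,s}^{X,Y}=|\{w\in R(\rho):des_{X,Y}(w)=s\}|$. For $x\in[m]$: $\alpha_{X,\rho,x}=\sum_{z\notin X,\ x<z\le m}\rho_z$ and $\beta_{Y,\rho,x}=\sum_{z\notin Y,\ 1\le z<x}\rho_z$. $\binom{a}{\rho_{v_1},\dots,\rho_{v_b}}$ is a multinomial coefficient. -}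

module Defs where

open import Data.Bool using (Bool; true; false; if_then_else_; _∧_; not)
open import Data.Nat using (ℕ; zero; suc; _+_; _*_; _∸_; _<_; _<ᵇ_; _≡ᵇ_; _!; _/_; NonZero)
open import Data.Nat.Properties using (_!≢0; m*n≢0)
open import Data.Nat.Combinatorics using (_C_)
open import Data.List using (List; []; _∷_; map; filter; length; foldr; concatMap)
open import Data.Nat.ListAction using (sum; product)
open import Data.Product using (_×_)
open import Data.List.Relation.Unary.All using (All)
open import Data.Integer as ℤ using (ℤ)
open import Relation.Binary.PropositionalEquality using (_≡_)

SubsetOfℕ : Set
SubsetOfℕ = ℕ → Bool

-- [a, b] = a, a+1, ..., b  (empty if b < a)
range : ℕ → ℕ → List ℕ
range a b = rangeFrom a (suc b ∸ a)
  where
  rangeFrom : ℕ → ℕ → List ℕ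
  rangeFrom x zero    = []
  rangeFrom x (suc k) = x ∷ rangeFrom (suc x) k

[_] : ℕ → List ℕ
[ m ] = range 1 m

IsComposition : List ℕ → ℕ → Set
IsComposition ρ n = All (λ k → 0 < k) ρ × sum ρ ≡ n

parts : List ℕ → ℕ
parts = length

-- ρ_x for x ∈ [m] (1-indexed); 0 outside [m]
part : List ℕ → ℕ → ℕ
part []      _             = 0
part (_ ∷ _) zero          = 0
part (r ∷ _) (suc zero)    = r
part (_ ∷ ρ) (suc (suc x)) = part ρ (suc x)

allWords : ℕ → ℕ → List (List ℕ)
allWords m zero    = [] ∷ []
allWords m (suc n) = concatMap (λ c → map (c ∷_) (allWords m n)) [ m ]

count : ℕ → List ℕ → ℕ
count x w = length (filter (λ y → y Data.Nat.≟ x) w)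

andAll : List Bool → Bool
andAll = foldr _∧_ true

hasContent : List ℕ → List ℕ → Bool
hasContent ρ w = andAll (map (λ x → count x w ≡ᵇ part ρ x) [ parts ρ ])

R : List ℕ → List (List ℕ)
R ρ = filter (λ w → Relation.Nullary.Decidable.Core.T? (hasContent ρ w)) (allWords (parts ρ) (sum ρ))
  where import Relation.Nullary.Decidable.Core

des : SubsetOfℕ → SubsetOfℕ → List ℕ → ℕ
des X Y []            = 0
des X Y (_ ∷ [])      = 0
des X Y (a ∷ b ∷ w)   =
  (if (b <ᵇ a) ∧ X a ∧ Y b then 1 else 0) + des X Y (b ∷ w)

P : SubsetOfℕ → SubsetOfℕ → List ℕ → ℕ → ℕ
P X Y ρ s = length (filter (λ w → des X Y w Data.Nat.≟ s) (R ρ))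

α : SubsetOfℕ → List ℕ → ℕ → ℕ
α X ρ x = sum (map (part ρ) (filter (λ z → Relation.Nullary.Decidable.Core.T? (not (X z))) (range (suc x) (parts ρ))))
  where import Relation.Nullary.Decidable.Core

β : SubsetOfℕ → List ℕ → ℕ → ℕ
β Y ρ x = sum (map (part ρ) (filter (λ z → Relation.Nullary.Decidable.Core.T? (not (Y z))) (range 1 (x ∸ 1))))
  where import Relation.Nullary.Decidable.Core

prod!≢0 : (ks : List ℕ) → NonZero (product (map _! ks))
prod!≢0 []       = _
prod!≢0 (k ∷ ks) = m*n≢0 (k !) (product (map _! ks)) {{k !≢0}} {{prod!≢0 ks}}

multinomial : List ℕ → ℕ
multinomial ks = (sum ks !) / product (map _! ks)
  where instance _ = prod!≢0 ks

sgn : ℕ → ℤ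
sgn zero    = ℤ.+ 1
sgn (suc k) = ℤ.- sgn k

Σℤ[r≤_] : ℕ → (ℕ → ℤ) → ℤ
Σℤ[r≤ s ] f = foldr ℤ._+_ (ℤ.+ 0) (map f (range 0 s))

compl : SubsetOfℕ → ℕ → List ℕ
compl X m = filter (λ z → Relation.Nullary.Decidable.Core.T? (not (X z))) [ m ]
  where import Relation.Nullary.Decidable.Core

inter : SubsetOfℕ → ℕ → List ℕ
inter X m = filter (λ z → Relation.Nullary.Decidable.Core.T? (X z)) [ m ]
  where import Relation.Nullary.Decidable.Core

RHS : SubsetOfℕ → SubsetOfℕ → List ℕ → ℕ → ℕ → ℤ
RHS X Y ρ n s =
  let m = parts ρ
      vs = compl X m
      a = sum (map (part ρ) vs)
  in ℤ.+ multinomial (map (part ρ) vs) ℤ.*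
     Σℤ[r≤ s ] (λ r →
        sgn (s ∸ r) ℤ.* ℤ.+ (((a + r) C r) * ((suc n) C (s ∸ r))
          * product (map (λ x → (part ρ x + r + α X ρ x + β Y ρ x) C part ρ x) (inter X m))))

-- Call the letter 0 a bar. The r bars can be placed into a word with n letters and d descents so that
-- every descent is broken by a bar in (n + r ∸ d) C n ways, so the number B r of descent-free words with
-- r bars and the letters of ρ is the binomial transform ∑ₛ P s · ((n + r ∸ s) C n) of the descent
-- distribution, which is inverted by P s = ∑_{r ≤ s} (-1)^(s - r) · ((n + 1) C (s - r)) · B r.
-- B r is counted by deleting the X-letters from the largest down. The largest remaining X-letter x
-- dominates the others: its ρ_x copies can only stand in front of a bar, of a letter below x outside Y,
-- of a letter above x outside X, or at the end, giving (ρ_x + r + α_x + β_x) C ρ_x choices. Once no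
-- X-letter is left no descent can occur, and the bars and the other letters are arranged in
-- ((a + r) C r) times the multinomial coefficient of ways.

module Submission where

open import Algebra.Bundles using (CommutativeSemigroup)
open import Algebra.Core using (Op₂)
import Algebra.Properties.CommutativeSemigroup
open import Algebra.Structures using (IsCommutativeSemiring)
open import Data.Bool using (Bool; true; false; not; _∧_; T?; if_then_else_)
open import Data.Bool.Properties using (T-≡; ∧-zeroʳ; ∧-identityʳ)
open import Data.List using (List; []; _∷_; _++_; map; concatMap; foldr; length; filter; filterᵇ)
open import Data.List.Properties using (filter-++; map-++; ++-identityʳ)
open import Data.List.Relation.Unary.All as All using (All; []; _∷_)
open import Data.List.Relation.Unary.All.Properties using (concat⁺; map⁺; filter⁺)
open import Data.Nat
  using (ℕ; zero; suc; _+_; _*_; _∸_; _≤_; _<_; z≤n; s≤s; s≤s⁻¹; z<s; _≡ᵇ_; _<ᵇ_; _≤ᵇ_; _≟_; _!)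
open import Data.Nat.Combinatorics
  using (_C_; nCn≡1; k>n⇒nCk≡0; nCk+nC[k+1]≡[n+1]C[k+1]; nCk≡n!/k![n-k]!; k![n∸k]!∣n!)
open import Data.Nat.DivMod using (_/_; m*n/n≡m; m/n*n≡m; /-congˡ)
open import Data.Nat.ListAction using (sum; product)
open import Data.Nat.ListAction.Properties using (product-++)
open import Data.Nat.Tactic.RingSolver using (solve-∀)
open import Data.Product as Product using (_×_; _,_; proj₁; proj₂)
open import Data.Sum using (_⊎_; inj₁; inj₂)
open import Function.Base using (_∘_)
open import Function.Bundles using (Equivalence)
open import Level using (0ℓ)
open import Relation.Binary.Definitions using (tri<; tri≈; tri>)
open import Relation.Binary.PropositionalEquality
  using (_≡_; _≢_; refl; sym; trans; cong; cong₂; subst; module ≡-Reasoning)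
open import Relation.Nullary using (¬_; contradiction; yes; no; does)
open import Relation.Unary using (Decidable)

open import Defs

-- Sums over lists

words : List ℕ → ℕ → List (List ℕ)
words A zero    = [] ∷ []
words A (suc n) = concatMap (λ c → map (c ∷_) (words A n)) A

module ListSum {S : Set} {_+_ _*_ : Op₂ S} {0# 1# : S}
               (isCommutativeSemiring : IsCommutativeSemiring _≡_ _+_ _*_ 0# 1#) where

  open IsCommutativeSemiring isCommutativeSemiring
    using (+-assoc; +-identityˡ; +-identityʳ; +-isCommutativeSemigroup; zeroʳ; distribˡ)

  private
    +-commutativeSemigroup : CommutativeSemigroup 0ℓ 0ℓ
    +-commutativeSemigroup = record { isCommutativeSemigroup = +-isCommutativeSemigroup }

  open Algebra.Properties.CommutativeSemigroup +-commutativeSemigroup using (interchange)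

  module _ {A : Set} where

    ∑ : (A → S) → List A → S
    ∑ f []       = 0#
    ∑ f (x ∷ xs) = f x + ∑ f xs

    ∑-cong : ∀ {f g} xs → (∀ x → f x ≡ g x) → ∑ f xs ≡ ∑ g xs
    ∑-cong []       f≗g = refl
    ∑-cong (x ∷ xs) f≗g = cong₂ _+_ (f≗g x) (∑-cong xs f≗g)

    ∑-congᴬ : ∀ {P : A → Set} {f g} xs → All P xs → (∀ x → P x → f x ≡ g x) → ∑ f xs ≡ ∑ g xs
    ∑-congᴬ []       []         f≗g = refl
    ∑-congᴬ (x ∷ xs) (px ∷ pxs) f≗g = cong₂ _+_ (f≗g x px) (∑-congᴬ xs pxs f≗g)

    ∑-++ : ∀ f xs ys → ∑ f (xs ++ ys) ≡ ∑ f xs + ∑ f ys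
    ∑-++ f []       ys = sym (+-identityˡ _)
    ∑-++ f (x ∷ xs) ys = trans (cong (f x +_) (∑-++ f xs ys)) (sym (+-assoc (f x) _ _))

    ∑-zero : ∀ xs → ∑ (λ _ → 0#) xs ≡ 0#
    ∑-zero []       = refl
    ∑-zero (x ∷ xs) = trans (+-identityˡ _) (∑-zero xs)

    ∑-distrib-+ : ∀ f g xs → ∑ (λ x → f x + g x) xs ≡ ∑ f xs + ∑ g xs
    ∑-distrib-+ f g []       = sym (+-identityˡ 0#)
    ∑-distrib-+ f g (x ∷ xs) =
      trans (cong ((f x + g x) +_) (∑-distrib-+ f g xs)) (interchange (f x) (g x) _ _)

    ∑-distribˡ-* : ∀ k f xs → ∑ (λ x → k * f x) xs ≡ k * ∑ f xs
    ∑-distribˡ-* k f []       = sym (zeroʳ k)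
    ∑-distribˡ-* k f (x ∷ xs) =
      trans (cong ((k * f x) +_) (∑-distribˡ-* k f xs)) (sym (distribˡ k (f x) _))

    foldr-map≡∑ : ∀ f xs → foldr _+_ 0# (map f xs) ≡ ∑ f xs
    foldr-map≡∑ f []       = refl
    foldr-map≡∑ f (x ∷ xs) = cong (f x +_) (foldr-map≡∑ f xs)

  module _ {A B : Set} where

    ∑-map : ∀ (f : B → S) (g : A → B) xs → ∑ f (map g xs) ≡ ∑ (λ x → f (g x)) xs
    ∑-map f g []       = refl
    ∑-map f g (x ∷ xs) = cong (f (g x) +_) (∑-map f g xs)

    ∑-concatMap : ∀ (f : B → S) (g : A → List B) xs →
                  ∑ f (concatMap g xs) ≡ ∑ (λ x → ∑ f (g x)) xs
    ∑-concatMap f g []       = refl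
    ∑-concatMap f g (x ∷ xs) =
      trans (∑-++ f (g x) (concatMap g xs)) (cong (∑ f (g x) +_) (∑-concatMap f g xs))

    ∑-comm : ∀ (f : A → B → S) xs ys →
             ∑ (λ x → ∑ (f x) ys) xs ≡ ∑ (λ y → ∑ (λ x → f x y) xs) ys
    ∑-comm f []       ys = sym (∑-zero ys)
    ∑-comm f (x ∷ xs) ys =
      trans (cong (∑ (f x) ys +_) (∑-comm f xs ys)) (sym (∑-distrib-+ (f x) _ ys))

  ∑-words-suc : ∀ f A n → ∑ f (words A (suc n)) ≡ ∑ (λ c → ∑ (λ w → f (c ∷ w)) (words A n)) A
  ∑-words-suc f A n =
    trans (∑-concatMap f _ A) (∑-cong A (λ c → ∑-map f (c ∷_) (words A n)))

  ∑-words-congᴬ : ∀ {Q : ℕ → Set} {f g} A → All Q A → ∀ n →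
                  (∀ w → All Q w → length w ≡ n → f w ≡ g w) →
                  ∑ f (words A n) ≡ ∑ g (words A n)
  ∑-words-congᴬ A QA zero    f≗g = cong (_+ 0#) (f≗g [] [] refl)
  ∑-words-congᴬ A QA (suc n) f≗g =
    trans (∑-words-suc _ A n)
      (trans (∑-congᴬ A QA (λ c Qc → ∑-words-congᴬ A QA n
                              (λ w Qw ∣w∣ → f≗g (c ∷ w) (Qc ∷ Qw) (cong suc ∣w∣))))
             (sym (∑-words-suc _ A n)))

words-length : ∀ A n → All (λ w → length w ≡ n) (words A n)
words-length A zero    = refl ∷ []
words-length A (suc n) =
  concat⁺ (map⁺ (All.universal (λ c → map⁺ (All.map (cong suc) (words-length A n))) A))

open import Data.Nat.Properties
open ListSum +-*-isCommutativeSemiring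
module +-CS = Algebra.Properties.CommutativeSemigroup +-commutativeSemigroup
module *-CS = Algebra.Properties.CommutativeSemigroup *-commutativeSemigroup

-- Letter counts and contents

𝟙 : Bool → ℕ
𝟙 true  = 1
𝟙 false = 0

𝟙-∧ : ∀ a b → 𝟙 (a ∧ b) ≡ 𝟙 a * 𝟙 b
𝟙-∧ true  b = sym (+-identityʳ (𝟙 b))
𝟙-∧ false b = refl

not≡true⇒≡false : ∀ {b} → not b ≡ true → b ≡ false
not≡true⇒≡false {false} _ = refl

≡ᵇ-refl : ∀ n → (n ≡ᵇ n) ≡ true
≡ᵇ-refl n = Equivalence.to T-≡ (≡⇒≡ᵇ n n refl)

≡ᵇ-sym : ∀ m n → (m ≡ᵇ n) ≡ (n ≡ᵇ m)
≡ᵇ-sym zero    zero    = refl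
≡ᵇ-sym zero    (suc n) = refl
≡ᵇ-sym (suc m) zero    = refl
≡ᵇ-sym (suc m) (suc n) = ≡ᵇ-sym m n

≡ᵇ-true⇒≡ : ∀ {m n} → (m ≡ᵇ n) ≡ true → m ≡ n
≡ᵇ-true⇒≡ {m} {n} e = ≡ᵇ⇒≡ m n (Equivalence.from T-≡ e)

≡ᵇ-false⇒≢ : ∀ {m n} → (m ≡ᵇ n) ≡ false → m ≢ n
≡ᵇ-false⇒≢ {m} e refl = contradiction (trans (sym (≡ᵇ-refl m)) e) λ ()

≢⇒≡ᵇ-false : ∀ {m n} → m ≢ n → (m ≡ᵇ n) ≡ false
≢⇒≡ᵇ-false {m} {n} m≢n with m ≡ᵇ n in e
... | false = refl
... | true  = contradiction (≡ᵇ-true⇒≡ e) m≢n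

<⇒<ᵇ-true : ∀ {m n} → m < n → (m <ᵇ n) ≡ true
<⇒<ᵇ-true m<n = Equivalence.to T-≡ (<⇒<ᵇ m<n)

≮⇒<ᵇ-false : ∀ {m n} → ¬ m < n → (m <ᵇ n) ≡ false
≮⇒<ᵇ-false {m} {n} m≮n with m <ᵇ n in e
... | false = refl
... | true  = contradiction (<ᵇ⇒< m n (Equivalence.from T-≡ e)) m≮n

<ᵇ-true⇒< : ∀ {m n} → (m <ᵇ n) ≡ true → m < n
<ᵇ-true⇒< {m} {n} e = <ᵇ⇒< m n (Equivalence.from T-≡ e)

occ : ℕ → List ℕ → ℕ
occ a []      = 0
occ a (y ∷ w) = 𝟙 (y ≡ᵇ a) + occ a w

count≡occ : ∀ a w → count a w ≡ occ a w
count≡occ a []      = refl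
count≡occ a (y ∷ w) with y ≡ᵇ a
... | true  = cong suc (count≡occ a w)
... | false = count≡occ a w

_∈!_ : ℕ → List ℕ → Set
a ∈! A = occ a A ≡ 1

∑-select : ∀ a (f : ℕ → ℕ) A → ∑ (λ c → 𝟙 (c ≡ᵇ a) * f c) A ≡ occ a A * f a
∑-select a f []      = refl
∑-select a f (c ∷ A) with c ≡ᵇ a in e
... | true  = cong₂ _+_ (trans (+-identityʳ (f c)) (cong f (≡ᵇ-true⇒≡ e))) (∑-select a f A)
... | false = ∑-select a f A

∑-filter : ∀ {A : Set} {P : A → Set} (P? : Decidable P) f xs →
           ∑ f (filter P? xs) ≡ ∑ (λ x → 𝟙 (does (P? x)) * f x) xs
∑-filter P? f []       = refl
∑-filter P? f (x ∷ xs) with does (P? x)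
... | true  = cong₂ _+_ (sym (+-identityʳ (f x))) (∑-filter P? f xs)
... | false = ∑-filter P? f xs

length≡∑1 : ∀ {A : Set} (xs : List A) → length xs ≡ ∑ (λ _ → 1) xs
length≡∑1 []       = refl
length≡∑1 (x ∷ xs) = cong suc (length≡∑1 xs)

<ᵇ-suc : ∀ t y → y ≢ suc t → (suc t <ᵇ y) ≡ (t <ᵇ y)
<ᵇ-suc zero    zero          _ = refl
<ᵇ-suc zero    (suc zero)    y≢1 = contradiction refl y≢1
<ᵇ-suc zero    (suc (suc y)) _ = refl
<ᵇ-suc (suc t) zero          _ = refl
<ᵇ-suc (suc t) (suc y)       y≢t = <ᵇ-suc t y (y≢t ∘ cong suc)

≤⇒≤ᵇ-true : ∀ {m n} → m ≤ n → (m ≤ᵇ n) ≡ true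
≤⇒≤ᵇ-true m≤n = Equivalence.to T-≡ (≤⇒≤ᵇ m≤n)

>⇒≤ᵇ-false : ∀ {m n} → n < m → (m ≤ᵇ n) ≡ false
>⇒≤ᵇ-false {m} {n} n<m with m ≤ᵇ n in e
... | false = refl
... | true  = contradiction (≤ᵇ⇒≤ m n (Equivalence.from T-≡ e)) (<⇒≱ n<m)

upFrom : ℕ → ℕ → List ℕ
upFrom a zero    = []
upFrom a (suc k) = a ∷ upFrom (suc a) k

range-cons : ∀ a b → a ≤ b → range a b ≡ a ∷ range (suc a) b
range-cons a b a≤b rewrite +-∸-assoc 1 a≤b = refl

range-nil : ∀ a b → b < a → range a b ≡ []
range-nil a b b<a rewrite m≤n⇒m∸n≡0 b<a = refl

range≡upFrom : ∀ a b → a ≤ suc b → range a b ≡ upFrom a (suc b ∸ a)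
range≡upFrom a b a≤1+b = go (suc b ∸ a) a (m+[n∸m]≡n a≤1+b)
  where
  go : ∀ k a → a + k ≡ suc b → range a b ≡ upFrom a k
  go zero    a a+0≡1+b = range-nil a b (≤-reflexive (trans (sym a+0≡1+b) (+-identityʳ a)))
  go (suc k) a a+k≡b   =
    trans (range-cons a b (s≤s⁻¹ (≤-trans (s≤s (m≤m+n a k)) (≤-reflexive (trans (sym (+-suc a k)) a+k≡b)))))
          (cong (a ∷_) (go k (suc a) (trans (sym (+-suc a k)) a+k≡b)))

[_]≡upFrom : ∀ m → [ m ] ≡ upFrom 1 m
[ m ]≡upFrom = range≡upFrom 1 m (s≤s z≤n)

upFrom-+ : ∀ a k l → upFrom a (k + l) ≡ upFrom a k ++ upFrom (a + k) l
upFrom-+ a zero    l = cong (λ b → upFrom b l) (sym (+-identityʳ a))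
upFrom-+ a (suc k) l =
  cong (a ∷_) (trans (upFrom-+ (suc a) k l) (cong (λ b → upFrom (suc a) k ++ upFrom b l) (sym (+-suc a k))))

upFrom-bounds : ∀ a k → All (λ y → a ≤ y × y < a + k) (upFrom a k)
upFrom-bounds a zero    = []
upFrom-bounds a (suc k) =
  (≤-refl , ≤-trans (s≤s (m≤m+n a k)) (≤-reflexive (sym (+-suc a k))))
  ∷ All.map (Product.map (≤-trans (n≤1+n a)) (λ y<a+k → ≤-trans y<a+k (≤-reflexive (sym (+-suc a k)))))
            (upFrom-bounds (suc a) k)

occ-upFrom-below : ∀ {y} a k → y < a → occ y (upFrom a k) ≡ 0
occ-upFrom-below a zero    y<a = refl
occ-upFrom-below {y} a (suc k) y<a with a ≡ᵇ y in e
... | true  = contradiction (≡ᵇ-true⇒≡ e) (>⇒≢ y<a)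
... | false = occ-upFrom-below (suc a) k (m≤n⇒m≤1+n y<a)

upFrom-unique : ∀ {y} a k → a ≤ y → y < a + k → y ∈! upFrom a k
upFrom-unique a zero    a≤y y<a+0 = contradiction (≤-trans y<a+0 (≤-reflexive (+-identityʳ a))) (≤⇒≯ a≤y)
upFrom-unique {y} a (suc k) a≤y y<a+k with a ≡ᵇ y in e
... | true  = cong suc (occ-upFrom-below (suc a) k (s≤s (≤-reflexive (sym (≡ᵇ-true⇒≡ e)))))
... | false = upFrom-unique (suc a) k (≤∧≢⇒< a≤y (≡ᵇ-false⇒≢ e)) (≤-trans y<a+k (≤-reflexive (+-suc a k)))

upFrom-distinct : ∀ a k → All (_∈! upFrom a k) (upFrom a k)
upFrom-distinct a k = All.map (λ (a≤y , y<a+k) → upFrom-unique a k a≤y y<a+k) (upFrom-bounds a k)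

upFrom-snoc : ∀ a k → upFrom a (suc k) ≡ upFrom a k ++ (a + k) ∷ []
upFrom-snoc a k = trans (cong (upFrom a) (+-comm 1 k)) (upFrom-+ a k 1)

filterᵇ-upFrom-snoc : ∀ (b : ℕ → Bool) k →
  filterᵇ b (upFrom 1 (suc k)) ≡ filterᵇ b (upFrom 1 k) ++ filterᵇ b (suc k ∷ [])
filterᵇ-upFrom-snoc b k = trans (cong (filterᵇ b) (upFrom-snoc 1 k)) (filter-++ (T? ∘ b) (upFrom 1 k) (suc k ∷ []))

_==_ : List ℕ → List ℕ → Bool
[]      == []      = true
[]      == (_ ∷ _) = false
(_ ∷ _) == []      = false
(a ∷ u) == (b ∷ v) = (a ≡ᵇ b) ∧ (u == v)

==-true⇒≡ : ∀ u v → (u == v) ≡ true → u ≡ v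
==-true⇒≡ []      []      _ = refl
==-true⇒≡ (a ∷ u) (b ∷ v) e with a ≡ᵇ b in a≡b
... | true = cong₂ _∷_ (≡ᵇ-true⇒≡ a≡b) (==-true⇒≡ u v e)

∑-words-== : ∀ A v → All (_∈! A) v → ∑ (λ u → 𝟙 (v == u)) (words A (length v)) ≡ 1
∑-words-== A []      []           = refl
∑-words-== A (a ∷ v) (a∈!A ∷ v∈!A) = begin
  ∑ (λ u → 𝟙 ((a ∷ v) == u)) (words A (suc (length v)))
    ≡⟨ ∑-words-suc _ A (length v) ⟩
  ∑ (λ c → ∑ (λ w → 𝟙 ((a ≡ᵇ c) ∧ (v == w))) (words A (length v))) A
    ≡⟨ ∑-cong A (λ c → trans (∑-cong (words A (length v)) (λ w → 𝟙-∧ (a ≡ᵇ c) (v == w)))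
                             (∑-distribˡ-* (𝟙 (a ≡ᵇ c)) _ (words A (length v)))) ⟩
  ∑ (λ c → 𝟙 (a ≡ᵇ c) * ∑ (λ w → 𝟙 (v == w)) (words A (length v))) A
    ≡⟨ ∑-cong A (λ c → cong₂ (λ b n → 𝟙 b * n) (≡ᵇ-sym a c) (∑-words-== A v v∈!A)) ⟩
  ∑ (λ c → 𝟙 (c ≡ᵇ a) * 1) A
    ≡⟨ ∑-select a (λ _ → 1) A ⟩
  occ a A * 1
    ≡⟨ trans (*-identityʳ _) a∈!A ⟩
  1 ∎
  where open ≡-Reasoning

andAll-cong : ∀ {P : ℕ → Set} {f g : ℕ → Bool} A → All P A → (∀ y → P y → f y ≡ g y) →
              andAll (map f A) ≡ andAll (map g A)
andAll-cong []      []         f≗g = refl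
andAll-cong (a ∷ A) (pa ∷ pA) f≗g = cong₂ _∧_ (f≗g a pa) (andAll-cong A pA f≗g)

andAll-true : ∀ (f : ℕ → Bool) A → andAll (map f A) ≡ true → All (λ y → f y ≡ true) A
andAll-true f []      _ = []
andAll-true f (a ∷ A) e with f a in fa
... | true = fa ∷ andAll-true f A e

andAll-false : ∀ (f : ℕ → Bool) {x} A → 1 ≤ occ x A → f x ≡ false → andAll (map f A) ≡ false
andAll-false f {x} (a ∷ A) x∈A fx with a ≡ᵇ x in e
... | true  = cong (_∧ andAll (map f A)) (trans (cong f (≡ᵇ-true⇒≡ e)) fx)
... | false rewrite andAll-false f A x∈A fx = ∧-zeroʳ (f a)

_∖_ : List ℕ → ℕ → List ℕ
A ∖ x = filterᵇ (λ y → not (y ≡ᵇ x)) A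

andAll-∖ : ∀ (f : ℕ → Bool) x A → f x ≡ true → andAll (map f (A ∖ x)) ≡ andAll (map f A)
andAll-∖ f x []      _  = refl
andAll-∖ f x (a ∷ A) fx with a ≡ᵇ x in e
... | true  = trans (andAll-∖ f x A fx) (cong (_∧ andAll (map f A)) (sym (trans (cong f (≡ᵇ-true⇒≡ e)) fx)))
... | false = cong (f a ∧_) (andAll-∖ f x A fx)

filterᵇ-true : ∀ (b : ℕ → Bool) A → All (λ y → b y ≡ true) (filterᵇ b A)
filterᵇ-true b []      = []
filterᵇ-true b (a ∷ A) with b a in e
... | true  = e ∷ filterᵇ-true b A
... | false = filterᵇ-true b A

occ-filterᵇ : ∀ (b : ℕ → Bool) {y} A → b y ≡ true → occ y (filterᵇ b A) ≡ occ y A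
occ-filterᵇ b     []      _  = refl
occ-filterᵇ b {y} (a ∷ A) by with b a in e
... | true  = cong (𝟙 (a ≡ᵇ y) +_) (occ-filterᵇ b A by)
... | false with a ≡ᵇ y in a≡y
...   | false = occ-filterᵇ b A by
...   | true  = contradiction (trans (sym e) (trans (cong b (≡ᵇ-true⇒≡ a≡y)) by)) λ ()

distinct-filterᵇ : ∀ (b : ℕ → Bool) A → All (_∈! A) A → All (_∈! filterᵇ b A) (filterᵇ b A)
distinct-filterᵇ b A A-distinct =
  All.zipWith (λ (by , y∈!A) → trans (occ-filterᵇ b A by) y∈!A)
              (filterᵇ-true b A , filter⁺ (T? ∘ b) A-distinct)

∑-∖ : ∀ f x A → ∑ f A ≡ ∑ f (A ∖ x) + occ x A * f x
∑-∖ f x []      = refl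
∑-∖ f x (a ∷ A) with a ≡ᵇ x in e
... | true  = trans (cong₂ _+_ (cong f (≡ᵇ-true⇒≡ e)) (∑-∖ f x A))
                  (+-CS.x∙yz≈y∙xz (f x) (∑ f (A ∖ x)) (occ x A * f x))
... | false = trans (cong (f a +_) (∑-∖ f x A)) (sym (+-assoc (f a) _ _))

∑-∖-∈! : ∀ f x A → x ∈! A → ∑ f A ≡ ∑ f (A ∖ x) + f x
∑-∖-∈! f x A x∈!A =
  trans (∑-∖ f x A) (trans (cong (λ k → ∑ f (A ∖ x) + k * f x) x∈!A) (cong (∑ f (A ∖ x) +_) (*-identityˡ (f x))))

∑-letters : ∀ (g : ℕ → ℕ) A u → All (_∈! A) u → ∑ g u ≡ ∑ (λ y → g y * occ y u) A
∑-letters g A []      []           = sym (trans (∑-cong A (λ y → *-zeroʳ (g y))) (∑-zero A))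
∑-letters g A (a ∷ u) (a∈!A ∷ u∈!A) = begin
  g a + ∑ g u
    ≡⟨ cong₂ _+_ (sym (trans (∑-select a g A) (trans (cong (_* g a) a∈!A) (*-identityˡ (g a)))))
                 (∑-letters g A u u∈!A) ⟩
  ∑ (λ y → 𝟙 (y ≡ᵇ a) * g y) A + ∑ (λ y → g y * occ y u) A
    ≡⟨ sym (∑-distrib-+ _ _ A) ⟩
  ∑ (λ y → 𝟙 (y ≡ᵇ a) * g y + g y * occ y u) A
    ≡⟨ ∑-cong A (λ y → trans (cong (_+ g y * occ y u) (trans (*-comm (𝟙 (y ≡ᵇ a)) (g y))
                                                              (cong (λ b → g y * 𝟙 b) (≡ᵇ-sym y a))))
                              (sym (*-distribˡ-+ (g y) _ _))) ⟩
  ∑ (λ y → g y * (𝟙 (a ≡ᵇ y) + occ y u)) A ∎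
  where open ≡-Reasoning

∑-words-select : ∀ A v (g : List ℕ → ℕ) → All (_∈! A) v →
                 ∑ (λ u → 𝟙 (v == u) * g u) (words A (length v)) ≡ g v
∑-words-select A v g v∈!A = begin
  ∑ (λ u → 𝟙 (v == u) * g u) (words A (length v))
    ≡⟨ ∑-cong (words A (length v)) select ⟩
  ∑ (λ u → 𝟙 (v == u) * g v) (words A (length v))
    ≡⟨ trans (∑-cong (words A (length v)) (λ u → *-comm (𝟙 (v == u)) (g v)))
             (∑-distribˡ-* (g v) _ (words A (length v))) ⟩
  g v * ∑ (λ u → 𝟙 (v == u)) (words A (length v))
    ≡⟨ trans (cong (g v *_) (∑-words-== A v v∈!A)) (*-identityʳ (g v)) ⟩
  g v ∎
  where
  open ≡-Reasoning
  select : ∀ u → 𝟙 (v == u) * g u ≡ 𝟙 (v == u) * g v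
  select u with v == u in v≡u
  ... | true  = cong (λ z → 1 * g z) (sym (==-true⇒≡ v u v≡u))
  ... | false = refl

hasContentOn : List ℕ → (ℕ → ℕ) → List ℕ → Bool
hasContentOn A c w = andAll (map (λ y → occ y w ≡ᵇ c y) A)

erase : ℕ → List ℕ → List ℕ
erase x []      = []
erase x (c ∷ w) = if c ≡ᵇ x then erase x w else c ∷ erase x w

occ-erase : ∀ x {y} w → (y ≡ᵇ x) ≡ false → occ y (erase x w) ≡ occ y w
occ-erase x     []      _   = refl
occ-erase x {y} (c ∷ w) y≢x with c ≡ᵇ x in c≡x
... | false = cong (𝟙 (c ≡ᵇ y) +_) (occ-erase x w y≢x)
... | true  = begin
  occ y (erase x w)         ≡⟨ occ-erase x w y≢x ⟩
  occ y w                   ≡⟨⟩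
  𝟙 false + occ y w         ≡⟨ cong (λ b → 𝟙 b + occ y w) c≢y ⟩
  𝟙 (c ≡ᵇ y) + occ y w      ∎
  where
  open ≡-Reasoning
  c≢y : false ≡ (c ≡ᵇ y)
  c≢y = trans (sym y≢x) (trans (≡ᵇ-sym y x) (cong (_≡ᵇ y) (sym (≡ᵇ-true⇒≡ {c} {x} c≡x))))

length-erase : ∀ x w → length (erase x w) + occ x w ≡ length w
length-erase x []      = refl
length-erase x (c ∷ w) with c ≡ᵇ x
... | true  = trans (+-suc _ _) (cong suc (length-erase x w))
... | false = cong suc (length-erase x w)

erase-All : ∀ {P : ℕ → Set} x w → All P w → All (λ y → P y × (y ≡ᵇ x) ≡ false) (erase x w)
erase-All x []      []         = []
erase-All x (c ∷ w) (pc ∷ pw) with c ≡ᵇ x in c≢x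
... | true  = erase-All x w pw
... | false = (pc , c≢x) ∷ erase-All x w pw

hasContentOn-erase : ∀ A x c w → (occ x w ≡ᵇ c x) ≡ true →
                     hasContentOn (A ∖ x) c (erase x w) ≡ hasContentOn A c w
hasContentOn-erase A x c w x-ok =
  trans (andAll-cong (A ∖ x) (filterᵇ-true _ A) same-occ) (andAll-∖ (λ y → occ y w ≡ᵇ c y) x A x-ok)
  where
  same-occ : ∀ y → not (y ≡ᵇ x) ≡ true → (occ y (erase x w) ≡ᵇ c y) ≡ (occ y w ≡ᵇ c y)
  same-occ y y≢x = cong (_≡ᵇ c y) (occ-erase x w (not≡true⇒≡false y≢x))

∑-erase-fiber : ∀ A x → x ∈! A → ∀ c (H : List ℕ → ℕ) w → All (_∈! A) w → length w ≡ ∑ c A →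
  ∑ (λ u → 𝟙 (hasContentOn (A ∖ x) c u) * (𝟙 (erase x w == u) * 𝟙 (occ x w ≡ᵇ c x) * H w))
    (words (A ∖ x) (∑ c (A ∖ x)))
  ≡ 𝟙 (hasContentOn A c w) * H w
∑-erase-fiber A x x∈!A c H w w∈!A ∣w∣ with occ x w ≡ᵇ c x in x-ok
... | false = begin
  ∑ (λ u → 𝟙 (content′ u) * (𝟙 (erase x w == u) * 0 * H w)) U
    ≡⟨ ∑-cong U (λ u → trans (cong (λ z → 𝟙 (content′ u) * (z * H w)) (*-zeroʳ (𝟙 (erase x w == u))))
                              (*-zeroʳ (𝟙 (content′ u)))) ⟩
  ∑ (λ _ → 0) U
    ≡⟨ ∑-zero U ⟩
  0
    ≡⟨ cong (λ b → 𝟙 b * H w) (sym (andAll-false _ A (≤-reflexive (sym x∈!A)) x-ok)) ⟩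
  𝟙 (hasContentOn A c w) * H w ∎
  where
  open ≡-Reasoning
  content′ : List ℕ → Bool
  content′ = hasContentOn (A ∖ x) c
  U : List (List ℕ)
  U = words (A ∖ x) (∑ c (A ∖ x))
... | true = begin
  ∑ (λ u → 𝟙 (content′ u) * (𝟙 (erase x w == u) * 1 * H w)) U
    ≡⟨ ∑-cong U (λ u → trans (cong (λ z → 𝟙 (content′ u) * (z * H w)) (*-identityʳ (𝟙 (erase x w == u))))
                              (*-CS.x∙yz≈y∙xz (𝟙 (content′ u)) (𝟙 (erase x w == u)) (H w))) ⟩
  ∑ (λ u → 𝟙 (erase x w == u) * (𝟙 (content′ u) * H w)) U
    ≡⟨ cong (λ M → ∑ (λ u → 𝟙 (erase x w == u) * (𝟙 (content′ u) * H w)) (words (A ∖ x) M)) (sym ∣erase-w∣) ⟩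
  ∑ (λ u → 𝟙 (erase x w == u) * (𝟙 (content′ u) * H w)) (words (A ∖ x) (length (erase x w)))
    ≡⟨ ∑-words-select (A ∖ x) (erase x w) (λ u → 𝟙 (content′ u) * H w) erase-w∈!A∖x ⟩
  𝟙 (content′ (erase x w)) * H w
    ≡⟨ cong (λ b → 𝟙 b * H w) (hasContentOn-erase A x c w x-ok) ⟩
  𝟙 (hasContentOn A c w) * H w ∎
  where
  open ≡-Reasoning
  content′ : List ℕ → Bool
  content′ = hasContentOn (A ∖ x) c
  U : List (List ℕ)
  U = words (A ∖ x) (∑ c (A ∖ x))
  erase-w∈!A∖x : All (_∈! (A ∖ x)) (erase x w)
  erase-w∈!A∖x = All.map (λ (y∈!A , y≢x) → trans (occ-filterᵇ _ A (cong not y≢x)) y∈!A) (erase-All x w w∈!A)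
  ∣erase-w∣ : length (erase x w) ≡ ∑ c (A ∖ x)
  ∣erase-w∣ = +-cancelʳ-≡ (c x) _ _ (begin
    length (erase x w) + c x      ≡⟨ cong (length (erase x w) +_) (sym (≡ᵇ-true⇒≡ x-ok)) ⟩
    length (erase x w) + occ x w  ≡⟨ length-erase x w ⟩
    length w                      ≡⟨ ∣w∣ ⟩
    ∑ c A                         ≡⟨ ∑-∖-∈! c x A x∈!A ⟩
    ∑ c (A ∖ x) + c x             ∎)

-- Every word over A is obtained from exactly one word over A ∖ x by inserting copies of x.
∑-by-erase : ∀ A x → All (_∈! A) A → x ∈! A → ∀ c (H : List ℕ → ℕ) →
  ∑ (λ w → 𝟙 (hasContentOn A c w) * H w) (words A (∑ c A)) ≡
  ∑ (λ u → 𝟙 (hasContentOn (A ∖ x) c u) *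
           ∑ (λ w → 𝟙 (erase x w == u) * 𝟙 (occ x w ≡ᵇ c x) * H w) (words A (∑ c A)))
    (words (A ∖ x) (∑ c (A ∖ x)))
∑-by-erase A x A-distinct x∈!A c H = sym (begin
  ∑ (λ u → 𝟙 (content′ u) * ∑ (summand u) W) U
    ≡⟨ ∑-cong U (λ u → sym (∑-distribˡ-* (𝟙 (content′ u)) (summand u) W)) ⟩
  ∑ (λ u → ∑ (λ w → 𝟙 (content′ u) * summand u w) W) U
    ≡⟨ ∑-comm (λ u w → 𝟙 (content′ u) * summand u w) U W ⟩
  ∑ (λ w → ∑ (λ u → 𝟙 (content′ u) * summand u w) U) W
    ≡⟨ ∑-words-congᴬ A A-distinct (∑ c A) (∑-erase-fiber A x x∈!A c H) ⟩
  ∑ (λ w → 𝟙 (hasContentOn A c w) * H w) W ∎)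
  where
  open ≡-Reasoning
  content′ : List ℕ → Bool
  content′ = hasContentOn (A ∖ x) c
  U W : List (List ℕ)
  U = words (A ∖ x) (∑ c (A ∖ x))
  W = words A (∑ c A)
  summand : List ℕ → List ℕ → ℕ
  summand u w = 𝟙 (erase x w == u) * 𝟙 (occ x w ≡ᵇ c x) * H w

filterᵇ-congᴬ : ∀ {P : ℕ → Set} {b d : ℕ → Bool} A → All P A → (∀ y → P y → b y ≡ d y) →
                filterᵇ b A ≡ filterᵇ d A
filterᵇ-congᴬ {b = b} {d} []      []        b≗d = refl
filterᵇ-congᴬ {b = b} {d} (a ∷ A) (pa ∷ pA) b≗d with b a | d a | b≗d a pa
... | true  | true  | _ = cong (a ∷_) (filterᵇ-congᴬ A pA b≗d)
... | false | false | _ = filterᵇ-congᴬ A pA b≗d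

map-congᴬ : ∀ {P : ℕ → Set} {f g : ℕ → ℕ} A → All P A → (∀ y → P y → f y ≡ g y) → map f A ≡ map g A
map-congᴬ []      []        f≗g = refl
map-congᴬ (a ∷ A) (pa ∷ pA) f≗g = cong₂ _∷_ (f≗g a pa) (map-congᴬ A pA f≗g)

filterᵇ-filterᵇ : ∀ (b d : ℕ → Bool) A → filterᵇ b (filterᵇ d A) ≡ filterᵇ (λ y → d y ∧ b y) A
filterᵇ-filterᵇ b d []      = refl
filterᵇ-filterᵇ b d (a ∷ A) with d a
... | false = filterᵇ-filterᵇ b d A
... | true  with b a
...   | true  = cong (a ∷_) (filterᵇ-filterᵇ b d A)
...   | false = filterᵇ-filterᵇ b d A

filterᵇ-all : ∀ (b : ℕ → Bool) A → All (λ y → b y ≡ true) A → filterᵇ b A ≡ A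
filterᵇ-all b []      []          = refl
filterᵇ-all b (a ∷ A) (ba ∷ bA) with b a | ba
... | true | _ = cong (a ∷_) (filterᵇ-all b A bA)

occ≡0⇒≢ : ∀ b A → occ b A ≡ 0 → All (λ y → (y ≡ᵇ b) ≡ false) A
occ≡0⇒≢ b []      _ = []
occ≡0⇒≢ b (a ∷ A) e with a ≡ᵇ b in a≢b
... | false = a≢b ∷ occ≡0⇒≢ b A e

∷-∖ : ∀ b A → b ∈! (b ∷ A) → (b ∷ A) ∖ b ≡ A
∷-∖ b A b∈! rewrite ≡ᵇ-refl b =
  filterᵇ-all _ A (All.map (cong not) (occ≡0⇒≢ b A (suc-injective b∈!)))

∷-distinct : ∀ b A → All (_∈! (b ∷ A)) (b ∷ A) → All (_∈! A) A
∷-distinct b A (b∈! ∷ A-ok) rewrite ≡ᵇ-refl b =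
  All.zipWith (λ {y} (y≢b , y∈!) → trans (cong (λ e → 𝟙 e + occ y A) (sym (trans (≡ᵇ-sym b y) y≢b))) y∈!)
              (occ≡0⇒≢ b A (suc-injective b∈!) , A-ok)

filterᵇ-accept : ∀ (b : ℕ → Bool) {y} ys → b y ≡ true → filterᵇ b (y ∷ ys) ≡ y ∷ filterᵇ b ys
filterᵇ-accept b ys by rewrite by = refl

filterᵇ-reject : ∀ (b : ℕ → Bool) {y} ys → b y ≡ false → filterᵇ b (y ∷ ys) ≡ filterᵇ b ys
filterᵇ-reject b ys by rewrite by = refl

-- Binomial and multinomial coefficients

C-∸-vanishes : ∀ n d → (n ∸ d) C suc n ≡ 0
C-∸-vanishes n d = k>n⇒nCk≡0 (s≤s (m∸n≤m n d))

C-∸-suc : ∀ n d → d ≤ n → (n ∸ d) C n ≡ (suc n ∸ d) C suc n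
C-∸-suc n zero    _   = trans (nCn≡1 n) (sym (nCn≡1 (suc n)))
C-∸-suc n (suc d) d<n = trans (k>n⇒nCk≡0 (∸-monoʳ-< {n} {suc d} {0} z<s d<n)) (sym (C-∸-vanishes n d))

pascal-∸ : ∀ n k d → d ≤ n → (suc n + k ∸ d) C suc n + (n + suc k ∸ d) C n ≡ (suc n + suc k ∸ d) C suc n
pascal-∸ n k d d≤n = begin
  (suc n + k ∸ d) C suc n + (n + suc k ∸ d) C n
    ≡⟨ cong₂ (λ a b → a C suc n + b C n) [1+n+k]∸d (trans (cong (_∸ d) (+-suc n k)) [1+n+k]∸d) ⟩
  suc j C suc n + suc j C n
    ≡⟨ +-comm (suc j C suc n) (suc j C n) ⟩
  suc j C n + suc j C suc n
    ≡⟨ nCk+nC[k+1]≡[n+1]C[k+1] (suc j) n ⟩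
  suc (suc j) C suc n
    ≡⟨ cong (_C suc n) (sym (trans (cong (λ m → suc m ∸ d) (+-suc n k)) (+-∸-assoc 2 d≤n+k))) ⟩
  (suc n + suc k ∸ d) C suc n ∎
  where
  open ≡-Reasoning
  j : ℕ
  j = n + k ∸ d
  d≤n+k : d ≤ n + k
  d≤n+k = ≤-trans d≤n (m≤m+n n k)
  [1+n+k]∸d : suc n + k ∸ d ≡ suc j
  [1+n+k]∸d = +-∸-assoc 1 d≤n+k

multinomial′ : List ℕ → ℕ
multinomial′ []       = 1
multinomial′ (k ∷ ks) = ((k + sum ks) C k) * multinomial′ ks

C*[!*!]≡! : ∀ k l → ((k + l) C k) * (k ! * l !) ≡ (k + l) !
C*[!*!]≡! k l = begin
  ((k + l) C k) * (k ! * l !)              ≡⟨ cong (λ n → ((k + l) C k) * (k ! * n !)) (sym (m+n∸m≡n k l)) ⟩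
  ((k + l) C k) * (k ! * (k + l ∸ k) !)    ≡⟨ cong (_* (k ! * (k + l ∸ k) !)) (nCk≡n!/k![n-k]! (m≤m+n k l)) ⟩
  (k + l) ! / (k ! * (k + l ∸ k) !) * (k ! * (k + l ∸ k) !)
    ≡⟨ m/n*n≡m {{k !* (k + l ∸ k) !≢0}} (k![n∸k]!∣n! (m≤m+n k l)) ⟩
  (k + l) ! ∎
  where
  open ≡-Reasoning
  instance _ = k !* (k + l ∸ k) !≢0

multinomial′*∏!≡! : ∀ ks → multinomial′ ks * product (map _! ks) ≡ sum ks !
multinomial′*∏!≡! []       = refl
multinomial′*∏!≡! (k ∷ ks) = begin
  ((k + sum ks) C k) * multinomial′ ks * (k ! * product (map _! ks))
    ≡⟨ regroup ((k + sum ks) C k) (multinomial′ ks) (k !) (product (map _! ks)) ⟩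
  ((k + sum ks) C k) * (k ! * (multinomial′ ks * product (map _! ks)))
    ≡⟨ cong (λ n → ((k + sum ks) C k) * (k ! * n)) (multinomial′*∏!≡! ks) ⟩
  ((k + sum ks) C k) * (k ! * sum ks !)
    ≡⟨ C*[!*!]≡! k (sum ks) ⟩
  (k + sum ks) ! ∎
  where
  open ≡-Reasoning
  regroup : ∀ a b c d → a * b * (c * d) ≡ a * (c * (b * d))
  regroup = solve-∀

multinomial≡multinomial′ : ∀ ks → multinomial ks ≡ multinomial′ ks
multinomial≡multinomial′ ks =
  trans (/-congˡ {{prod!≢0 ks}} (sym (multinomial′*∏!≡! ks)))
        (m*n/n≡m (multinomial′ ks) (product (map _! ks)) {{prod!≢0 ks}})

-- Descent-free words and insertions

des-∷-≤ : ∀ X Y a w → des X Y (a ∷ w) ≤ length w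
des-∷-≤ X Y a []      = z≤n
des-∷-≤ X Y a (b ∷ w) with (b <ᵇ a) ∧ X a ∧ Y b
... | true  = s≤s (des-∷-≤ X Y b w)
... | false = m≤n⇒m≤1+n (des-∷-≤ X Y b w)

des-≤-length : ∀ X Y w → des X Y w ≤ length w
des-≤-length X Y []      = z≤n
des-≤-length X Y (a ∷ w) = m≤n⇒m≤1+n (des-∷-≤ X Y a w)

module DescentFree (X Y : SubsetOfℕ) where

  -- The letter 0 plays the role of a bar: it lies in neither set, so it never takes part in a descent.
  X⁺ Y⁺ : SubsetOfℕ
  X⁺ zero    = false
  X⁺ (suc z) = X (suc z)
  Y⁺ zero    = false
  Y⁺ (suc z) = Y (suc z)

  isDescent : ℕ → ℕ → Bool
  isDescent a b = (b <ᵇ a) ∧ X⁺ a ∧ Y⁺ b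

  noDescent : ℕ → ℕ → Bool
  noDescent a b = not (isDescent a b)

  descentFree : List ℕ → Bool
  descentFree []          = true
  descentFree (a ∷ [])    = true
  descentFree (a ∷ b ∷ w) = noDescent a b ∧ descentFree (b ∷ w)

  descents : List ℕ → ℕ
  descents = des X⁺ Y⁺

  countFree : List ℕ → (ℕ → ℕ) → ℕ
  countFree A c = ∑ (λ w → 𝟙 (hasContentOn A c w) * 𝟙 (descentFree w)) (words A (∑ c A))

  noDescent-0 : ∀ p → noDescent p 0 ≡ true
  noDescent-0 zero    = refl
  noDescent-0 (suc p) = cong not (∧-zeroʳ (X (suc p)))

  descentFree-0∷ : ∀ w → descentFree (0 ∷ w) ≡ descentFree w
  descentFree-0∷ []      = refl
  descentFree-0∷ (b ∷ w) = refl

  descents-0∷ : ∀ w → descents (0 ∷ w) ≡ descents w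
  descents-0∷ []      = refl
  descents-0∷ (b ∷ w) = refl

  descents≡des : ∀ w → All (1 ≤_) w → descents w ≡ des X Y w
  descents≡des []                  _                 = refl
  descents≡des (a ∷ [])            _                 = refl
  descents≡des (suc a ∷ suc b ∷ w) (_ ∷ 1≤b ∷ 1≤w) =
    cong ((if (suc b <ᵇ suc a) ∧ X (suc a) ∧ Y (suc b) then 1 else 0) +_) (descents≡des (suc b ∷ w) (1≤b ∷ 1≤w))

  descents-∷∷ : ∀ a b w → descents (a ∷ b ∷ w) ≡ 𝟙 (isDescent a b) + descents (b ∷ w)
  descents-∷∷ a b w with isDescent a b
  ... | true  = refl
  ... | false = refl

  isDescent-intro : ∀ {x y} → y < x → X⁺ x ≡ true → Y⁺ y ≡ true → isDescent x y ≡ true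
  isDescent-intro y<x x∈X y∈Y rewrite <⇒<ᵇ-true y<x | x∈X | y∈Y = refl

  -- When x dominates y, the factor y x is never a descent, and y z is one only if x z is.
  _dominates_ : ℕ → ℕ → Set
  x dominates y = (y ≡ x) ⊎ (X⁺ y ≡ true → y < x × X⁺ x ≡ true)

  noDescent-onto : ∀ {x p} → x dominates p → noDescent p x ≡ true
  noDescent-onto {x} (inj₁ refl) = cong (λ b → not (b ∧ X⁺ x ∧ Y⁺ x)) (≮⇒<ᵇ-false {x} (<-irrefl refl))
  noDescent-onto {x} {p} (inj₂ x≻p) with X⁺ p in p∈X
  ... | false = cong not (∧-zeroʳ (x <ᵇ p))
  ... | true  = cong (λ b → not (b ∧ Y⁺ x)) (≮⇒<ᵇ-false (<-asym (proj₁ (x≻p refl))))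

  isDescent-elim : ∀ {a b} → isDescent a b ≡ true → b < a × X⁺ a ≡ true × Y⁺ b ≡ true
  isDescent-elim {a} {b} e with b <ᵇ a in b<a | X⁺ a | Y⁺ b
  isDescent-elim {a} {b} () | false | _     | _
  isDescent-elim {a} {b} () | true  | false | _
  isDescent-elim {a} {b} () | true  | true  | false
  isDescent-elim {a} {b} _  | true  | true  | true  = <ᵇ-true⇒< b<a , refl , refl

  isDescent-transfer : ∀ {x p y} → x dominates p → isDescent p y ≡ true → isDescent x y ≡ true
  isDescent-transfer (inj₁ refl) p↘y = p↘y
  isDescent-transfer (inj₂ x≻p)  p↘y with isDescent-elim p↘y
  ... | y<p , p∈X , y∈Y = isDescent-intro (<-trans y<p (proj₁ (x≻p p∈X))) (proj₂ (x≻p p∈X)) y∈Y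

  noDescent-transfer : ∀ {x p y} → x dominates p → noDescent x y ≡ true → noDescent p y ≡ true
  noDescent-transfer {x} {p} {y} x≽p x↛y with isDescent p y in p↘y
  ... | false = refl
  ... | true  = contradiction (trans (sym x↛y) (cong not (isDescent-transfer x≽p p↘y))) λ ()

  module Insertion (A : List ℕ) (x : ℕ) where

    inserts : ℕ → List ℕ → ℕ → List ℕ → ℕ
    inserts p u k w = 𝟙 (erase x w == u) * 𝟙 (occ x w ≡ᵇ k) * 𝟙 (descentFree (p ∷ w))

    insertions : ℕ → List ℕ → ℕ → ℕ → ℕ
    insertions p u k N = ∑ (inserts p u k) (words A N)

    leadingX : ℕ → List ℕ → ℕ → ℕ → ℕ
    leadingX p u zero    N = 0
    leadingX p u (suc k) N = 𝟙 (noDescent p x) * insertions x u k N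

    leadingU : ℕ → List ℕ → ℕ → ℕ → ℕ
    leadingU p []      k N = 0
    leadingU p (u₁ ∷ u) k N = 𝟙 (noDescent p u₁) * insertions u₁ u k N

    private
      leadingLetter : ℕ → List ℕ → ℕ → ℕ → ℕ → ℕ
      leadingLetter p []       k N c = 0
      leadingLetter p (u₁ ∷ u) k N c = 𝟙 (c ≡ᵇ u₁) * (𝟙 (noDescent p c) * insertions c u k N)

      ∑-inserts-∷ : ∀ p u k N c →
        ∑ (λ w → inserts p u k (c ∷ w)) (words A N) ≡
        𝟙 (c ≡ᵇ x) * leadingX p u k N + 𝟙 (not (c ≡ᵇ x)) * leadingLetter p u k N c
      ∑-inserts-∷ p u k N c with c ≡ᵇ x in c≡x
      ∑-inserts-∷ p u zero    N c | true =
        trans (∑-cong (words A N) (λ w → cong (_* 𝟙 (descentFree (p ∷ c ∷ w))) (*-zeroʳ (𝟙 (erase x w == u)))))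
              (∑-zero (words A N))
      ∑-inserts-∷ p u (suc k) N c | true with refl ← ≡ᵇ-true⇒≡ {c} c≡x = begin
        ∑ (λ w → a w * 𝟙 (noDescent p x ∧ descentFree (x ∷ w))) (words A N)
          ≡⟨ ∑-cong (words A N) (λ w → trans (cong (a w *_) (𝟙-∧ (noDescent p x) (descentFree (x ∷ w))))
                                              (*-CS.x∙yz≈y∙xz (a w) (𝟙 (noDescent p x)) (𝟙 (descentFree (x ∷ w))))) ⟩
        ∑ (λ w → 𝟙 (noDescent p x) * (a w * 𝟙 (descentFree (x ∷ w)))) (words A N)
          ≡⟨ ∑-distribˡ-* (𝟙 (noDescent p x)) _ (words A N) ⟩
        𝟙 (noDescent p x) * insertions x u k N
          ≡⟨ sym (trans (+-identityʳ _) (*-identityˡ _)) ⟩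
        1 * (𝟙 (noDescent p x) * insertions x u k N) + 0 ∎
        where
        open ≡-Reasoning
        a : List ℕ → ℕ
        a w = 𝟙 (erase x w == u) * 𝟙 (occ x w ≡ᵇ k)
      ∑-inserts-∷ p []       k N c | false = ∑-zero (words A N)
      ∑-inserts-∷ p (u₁ ∷ u) k N c | false = begin
        ∑ (λ w → 𝟙 ((c ≡ᵇ u₁) ∧ (erase x w == u)) * 𝟙 (occ x w ≡ᵇ k) * 𝟙 (noDescent p c ∧ descentFree (c ∷ w)))
          (words A N)
          ≡⟨ ∑-cong (words A N) (λ w →
               trans (cong₂ (λ e d → e * 𝟙 (occ x w ≡ᵇ k) * d)
                            (𝟙-∧ (c ≡ᵇ u₁) (erase x w == u)) (𝟙-∧ (noDescent p c) (descentFree (c ∷ w))))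
                     (regroup (𝟙 (c ≡ᵇ u₁)) (𝟙 (erase x w == u)) (𝟙 (occ x w ≡ᵇ k))
                              (𝟙 (noDescent p c)) (𝟙 (descentFree (c ∷ w))))) ⟩
        ∑ (λ w → 𝟙 (c ≡ᵇ u₁) * (𝟙 (noDescent p c) * inserts c u k w)) (words A N)
          ≡⟨ trans (∑-distribˡ-* (𝟙 (c ≡ᵇ u₁)) _ (words A N))
                   (cong (𝟙 (c ≡ᵇ u₁) *_) (∑-distribˡ-* (𝟙 (noDescent p c)) _ (words A N))) ⟩
        𝟙 (c ≡ᵇ u₁) * (𝟙 (noDescent p c) * insertions c u k N)
          ≡⟨ sym (*-identityˡ _) ⟩
        1 * (𝟙 (c ≡ᵇ u₁) * (𝟙 (noDescent p c) * insertions c u k N)) ∎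
        where
        open ≡-Reasoning
        regroup : ∀ e r o q d → e * r * o * (q * d) ≡ e * (q * (r * o * d))
        regroup = solve-∀

    Insertable : List ℕ → Set
    Insertable = All (λ y → y ∈! A × (y ≡ᵇ x) ≡ false)

    insertions-suc : x ∈! A → ∀ p u k N → Insertable u →
                     insertions p u k (suc N) ≡ leadingX p u k N + leadingU p u k N
    insertions-suc x∈!A p u k N u-ok = begin
      insertions p u k (suc N)
        ≡⟨ ∑-words-suc (inserts p u k) A N ⟩
      ∑ (λ c → ∑ (λ w → inserts p u k (c ∷ w)) (words A N)) A
        ≡⟨ ∑-cong A (∑-inserts-∷ p u k N) ⟩
      ∑ (λ c → 𝟙 (c ≡ᵇ x) * leadingX p u k N + 𝟙 (not (c ≡ᵇ x)) * leadingLetter p u k N c) A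
        ≡⟨ ∑-distrib-+ _ _ A ⟩
      ∑ (λ c → 𝟙 (c ≡ᵇ x) * leadingX p u k N) A + ∑ (λ c → 𝟙 (not (c ≡ᵇ x)) * leadingLetter p u k N c) A
        ≡⟨ cong₂ _+_ (trans (∑-select x (λ _ → leadingX p u k N) A)
                            (trans (cong (_* leadingX p u k N) x∈!A) (*-identityˡ _)))
                     (∑-leadingLetter u u-ok) ⟩
      leadingX p u k N + leadingU p u k N ∎
      where
      open ≡-Reasoning
      ∑-leadingLetter : ∀ u → Insertable u →
        ∑ (λ c → 𝟙 (not (c ≡ᵇ x)) * leadingLetter p u k N c) A ≡ leadingU p u k N
      ∑-leadingLetter [] _ = trans (∑-cong A (λ c → *-zeroʳ (𝟙 (not (c ≡ᵇ x))))) (∑-zero A)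
      ∑-leadingLetter (u₁ ∷ u) ((u₁∈!A , u₁≢x) ∷ _) = begin
        ∑ (λ c → 𝟙 (not (c ≡ᵇ x)) * (𝟙 (c ≡ᵇ u₁) * G c)) A
          ≡⟨ ∑-cong A (λ c → *-CS.x∙yz≈y∙xz (𝟙 (not (c ≡ᵇ x))) (𝟙 (c ≡ᵇ u₁)) (G c)) ⟩
        ∑ (λ c → 𝟙 (c ≡ᵇ u₁) * (𝟙 (not (c ≡ᵇ x)) * G c)) A
          ≡⟨ ∑-select u₁ (λ c → 𝟙 (not (c ≡ᵇ x)) * G c) A ⟩
        occ u₁ A * (𝟙 (not (u₁ ≡ᵇ x)) * G u₁)
          ≡⟨ cong₂ (λ n b → n * (𝟙 (not b) * G u₁)) u₁∈!A u₁≢x ⟩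
        1 * (1 * G u₁)
          ≡⟨ trans (*-identityˡ _) (*-identityˡ _) ⟩
        G u₁ ∎
        where
        G : ℕ → ℕ
        G c = 𝟙 (noDescent p c) * insertions c u k N

    freeSlots : List ℕ → ℕ
    freeSlots = ∑ (λ y → 𝟙 (noDescent x y))

    -- The copies of x go into the freeSlots u gaps in front of letters that may follow x, or at the end.
    insertions-dominant : x ∈! A → ∀ p u k → x dominates p → Insertable u → All (x dominates_) u →
      insertions p u k (length u + k) ≡ 𝟙 (descentFree (p ∷ u)) * ((k + freeSlots u) C k)
    insertions-dominant x∈!A p [] zero    x≽p [] [] = refl
    insertions-dominant x∈!A p [] (suc k) x≽p [] [] = begin
      insertions p [] (suc k) (suc k)
        ≡⟨ insertions-suc x∈!A p [] (suc k) k [] ⟩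
      𝟙 (noDescent p x) * insertions x [] k k + 0
        ≡⟨ cong₂ (λ b n → 𝟙 b * n + 0) (noDescent-onto x≽p)
                 (insertions-dominant x∈!A x [] k (inj₁ refl) [] []) ⟩
      1 * (1 * ((k + 0) C k)) + 0
        ≡⟨ trans (+-identityʳ _) (trans (*-identityˡ _) (*-identityˡ _)) ⟩
      (k + 0) C k
        ≡⟨ trans (cong (_C k) (+-identityʳ k)) (trans (nCn≡1 k) (sym (nCn≡1 (suc k)))) ⟩
      suc k C suc k
        ≡⟨ trans (cong (_C suc k) (sym (+-identityʳ (suc k)))) (sym (*-identityˡ _)) ⟩
      1 * ((suc k + 0) C suc k) ∎
      where open ≡-Reasoning
    insertions-dominant x∈!A p (u₁ ∷ u) zero x≽p (u₁-ok ∷ u-ok) (x≽u₁ ∷ x≽u) = begin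
      insertions p (u₁ ∷ u) 0 (suc (length u + 0))
        ≡⟨ insertions-suc x∈!A p (u₁ ∷ u) 0 (length u + 0) (u₁-ok ∷ u-ok) ⟩
      𝟙 (noDescent p u₁) * insertions u₁ u 0 (length u + 0)
        ≡⟨ cong (𝟙 (noDescent p u₁) *_) (insertions-dominant x∈!A u₁ u 0 x≽u₁ u-ok x≽u) ⟩
      𝟙 (noDescent p u₁) * (𝟙 (descentFree (u₁ ∷ u)) * 1)
        ≡⟨ sym (trans (cong (_* 1) (𝟙-∧ (noDescent p u₁) _))
                      (*-assoc (𝟙 (noDescent p u₁)) (𝟙 (descentFree (u₁ ∷ u))) 1)) ⟩
      𝟙 (noDescent p u₁ ∧ descentFree (u₁ ∷ u)) * 1 ∎
      where open ≡-Reasoning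
    insertions-dominant x∈!A p (u₁ ∷ u) (suc k) x≽p (u₁-ok ∷ u-ok) (x≽u₁ ∷ x≽u) = begin
      insertions p (u₁ ∷ u) (suc k) (suc (length u + suc k))
        ≡⟨ insertions-suc x∈!A p (u₁ ∷ u) (suc k) (length u + suc k) (u₁-ok ∷ u-ok) ⟩
      𝟙 (noDescent p x) * insertions x (u₁ ∷ u) k (length u + suc k)
        + 𝟙 (noDescent p u₁) * insertions u₁ u (suc k) (length u + suc k)
        ≡⟨ cong₂ _+_
             (cong₂ (λ b n → 𝟙 b * n) (noDescent-onto x≽p)
                    (trans (cong (insertions x (u₁ ∷ u) k) (+-suc (length u) k))
                           (insertions-dominant x∈!A x (u₁ ∷ u) k (inj₁ refl) (u₁-ok ∷ u-ok) (x≽u₁ ∷ x≽u))))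
             (cong (𝟙 (noDescent p u₁) *_) (insertions-dominant x∈!A u₁ u (suc k) x≽u₁ u-ok x≽u)) ⟩
      1 * (𝟙 (noDescent x u₁ ∧ free) * ((k + (𝟙 (noDescent x u₁) + freeSlots u)) C k))
        + 𝟙 (noDescent p u₁) * (𝟙 free * ((suc k + freeSlots u) C suc k))
        ≡⟨ combine (noDescent x u₁) refl ⟩
      𝟙 (noDescent p u₁ ∧ free) * ((suc k + (𝟙 (noDescent x u₁) + freeSlots u)) C suc k) ∎
      where
      open ≡-Reasoning
      free : Bool
      free = descentFree (u₁ ∷ u)
      F : ℕ
      F = freeSlots u
      combine : ∀ b → noDescent x u₁ ≡ b →
        1 * (𝟙 (b ∧ free) * ((k + (𝟙 b + F)) C k)) + 𝟙 (noDescent p u₁) * (𝟙 free * ((suc k + F) C suc k))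
        ≡ 𝟙 (noDescent p u₁ ∧ free) * ((suc k + (𝟙 b + F)) C suc k)
      combine false _ = sym (trans (cong (_* ((suc k + F) C suc k)) (𝟙-∧ (noDescent p u₁) free))
                                  (*-assoc (𝟙 (noDescent p u₁)) (𝟙 free) ((suc k + F) C suc k)))
      combine true  x↛u₁ rewrite noDescent-transfer x≽p x↛u₁ = begin
        1 * (𝟙 free * ((k + suc F) C k)) + 1 * (𝟙 free * ((suc k + F) C suc k))
          ≡⟨ cong₂ _+_ (*-identityˡ (𝟙 free * ((k + suc F) C k))) (*-identityˡ (𝟙 free * ((suc k + F) C suc k))) ⟩
        𝟙 free * ((k + suc F) C k) + 𝟙 free * ((suc k + F) C suc k)
          ≡⟨ sym (*-distribˡ-+ (𝟙 free) _ _) ⟩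
        𝟙 free * ((k + suc F) C k + suc (k + F) C suc k)
          ≡⟨ cong (λ n → 𝟙 free * (n C k + suc (k + F) C suc k)) (+-suc k F) ⟩
        𝟙 free * (suc (k + F) C k + suc (k + F) C suc k)
          ≡⟨ cong (𝟙 free *_) (nCk+nC[k+1]≡[n+1]C[k+1] (suc (k + F)) k) ⟩
        𝟙 free * (suc (suc (k + F)) C suc k)
          ≡⟨ cong (λ n → 𝟙 free * (suc n C suc k)) (sym (+-suc k F)) ⟩
        𝟙 free * ((suc k + suc F) C suc k) ∎

  module _ (A : List ℕ) where
    open Insertion A 0

    -- A bar must separate each descent of p ∷ u; the remaining bars are placed freely.
    insertions-bars : 0 ∈! A → ∀ p u k → Insertable u →
      insertions p u k (length u + k) ≡ (length u + k ∸ descents (p ∷ u)) C length u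
    insertions-bars 0∈!A p []       zero    [] = refl
    insertions-bars 0∈!A p []       (suc k) [] =
      trans (insertions-suc 0∈!A p [] (suc k) k [])
            (cong₂ (λ b n → 𝟙 b * n + 0) (noDescent-0 p) (insertions-bars 0∈!A 0 [] k []))
    insertions-bars 0∈!A p (u₁ ∷ u) zero (u₁-ok ∷ u-ok) = begin
      insertions p (u₁ ∷ u) 0 (suc (length u + 0))
        ≡⟨ insertions-suc 0∈!A p (u₁ ∷ u) 0 (length u + 0) (u₁-ok ∷ u-ok) ⟩
      𝟙 (noDescent p u₁) * insertions u₁ u 0 (length u + 0)
        ≡⟨ cong (𝟙 (noDescent p u₁) *_) (insertions-bars 0∈!A u₁ u 0 u-ok) ⟩
      𝟙 (noDescent p u₁) * ((length u + 0 ∸ d) C length u)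
        ≡⟨ cong (λ n → 𝟙 (noDescent p u₁) * ((n ∸ d) C length u)) (+-identityʳ (length u)) ⟩
      𝟙 (noDescent p u₁) * ((length u ∸ d) C length u)
        ≡⟨ by-descent (isDescent p u₁) ⟩
      (suc (length u) ∸ (𝟙 (isDescent p u₁) + d)) C suc (length u)
        ≡⟨ cong₂ (λ n e → (suc n ∸ e) C suc (length u)) (sym (+-identityʳ (length u))) (sym (descents-∷∷ p u₁ u)) ⟩
      (suc (length u + 0) ∸ descents (p ∷ u₁ ∷ u)) C suc (length u) ∎
      where
      open ≡-Reasoning
      d : ℕ
      d = descents (u₁ ∷ u)
      by-descent : ∀ b → 𝟙 (not b) * ((length u ∸ d) C length u) ≡ (suc (length u) ∸ (𝟙 b + d)) C suc (length u)
      by-descent false = trans (*-identityˡ ((length u ∸ d) C length u)) (C-∸-suc (length u) d (des-∷-≤ X⁺ Y⁺ u₁ u))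
      by-descent true  = sym (C-∸-vanishes (length u) d)
    insertions-bars 0∈!A p (u₁ ∷ u) (suc k) (u₁-ok ∷ u-ok) = begin
      insertions p (u₁ ∷ u) (suc k) (suc (length u + suc k))
        ≡⟨ insertions-suc 0∈!A p (u₁ ∷ u) (suc k) (length u + suc k) (u₁-ok ∷ u-ok) ⟩
      𝟙 (noDescent p 0) * insertions 0 (u₁ ∷ u) k (length u + suc k)
        + 𝟙 (noDescent p u₁) * insertions u₁ u (suc k) (length u + suc k)
        ≡⟨ cong₂ _+_
             (cong₂ (λ b n → 𝟙 b * n) (noDescent-0 p)
                    (trans (cong (insertions 0 (u₁ ∷ u) k) (+-suc (length u) k))
                           (insertions-bars 0∈!A 0 (u₁ ∷ u) k (u₁-ok ∷ u-ok))))
             (cong (𝟙 (noDescent p u₁) *_) (insertions-bars 0∈!A u₁ u (suc k) u-ok)) ⟩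
      1 * ((suc (length u) + k ∸ descents (0 ∷ u₁ ∷ u)) C suc (length u))
        + 𝟙 (noDescent p u₁) * ((length u + suc k ∸ d) C length u)
        ≡⟨ cong (λ e → 1 * ((suc (length u) + k ∸ e) C suc (length u))
                       + 𝟙 (noDescent p u₁) * ((length u + suc k ∸ d) C length u))
                (descents-0∷ (u₁ ∷ u)) ⟩
      1 * ((suc (length u) + k ∸ d) C suc (length u)) + 𝟙 (noDescent p u₁) * ((length u + suc k ∸ d) C length u)
        ≡⟨ by-descent (isDescent p u₁) ⟩
      (suc (length u + suc k) ∸ (𝟙 (isDescent p u₁) + d)) C suc (length u)
        ≡⟨ cong (λ e → (suc (length u + suc k) ∸ e) C suc (length u)) (sym (descents-∷∷ p u₁ u)) ⟩
      (suc (length u + suc k) ∸ descents (p ∷ u₁ ∷ u)) C suc (length u) ∎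
      where
      open ≡-Reasoning
      d n : ℕ
      d = descents (u₁ ∷ u)
      n = length u
      by-descent : ∀ b → 1 * ((suc n + k ∸ d) C suc n) + 𝟙 (not b) * ((n + suc k ∸ d) C n)
                         ≡ (suc (n + suc k) ∸ (𝟙 b + d)) C suc n
      by-descent false = trans (cong₂ _+_ (*-identityˡ ((suc n + k ∸ d) C suc n)) (*-identityˡ ((n + suc k ∸ d) C n)))
                               (pascal-∸ n k d (des-∷-≤ X⁺ Y⁺ u₁ u))
      by-descent true  = trans (+-identityʳ _) (trans (*-identityˡ ((suc n + k ∸ d) C suc n))
                                                      (cong (λ m → (m ∸ d) C suc n) (sym (+-suc n k))))

  countFree-by-erase : ∀ A x → All (_∈! A) A → x ∈! A → ∀ c →
    countFree A c ≡
    ∑ (λ u → 𝟙 (hasContentOn (A ∖ x) c u) * Insertion.insertions A x 0 u (c x) (length u + c x))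
      (words (A ∖ x) (∑ c (A ∖ x)))
  countFree-by-erase A x A-distinct x∈!A c =
    trans (∑-by-erase A x A-distinct x∈!A c (λ w → 𝟙 (descentFree w)))
          (∑-words-congᴬ (A ∖ x) (distinct-filterᵇ _ A A-distinct) (∑ c (A ∖ x)) λ u _ ∣u∣ →
             cong (𝟙 (hasContentOn (A ∖ x) c u) *_)
               (trans (∑-cong (words A (∑ c A))
                        (λ w → cong (λ b → 𝟙 (erase x w == u) * 𝟙 (occ x w ≡ᵇ c x) * 𝟙 b) (sym (descentFree-0∷ w))))
                      (cong (Insertion.insertions A x 0 u (c x))
                            (trans (∑-∖-∈! c x A x∈!A) (cong (_+ c x) (sym ∣u∣))))))

  countFree-dominant : ∀ A x → All (_∈! A) A → x ∈! A → All (x dominates_) A → ∀ c →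
    countFree A c ≡ ((c x + ∑ (λ y → 𝟙 (noDescent x y) * c y) (A ∖ x)) C c x) * countFree (A ∖ x) c
  countFree-dominant A x A-distinct x∈!A x≽A c = begin
    countFree A c
      ≡⟨ countFree-by-erase A x A-distinct x∈!A c ⟩
    ∑ (λ u → 𝟙 (hasContentOn A′ c u) * insertions 0 u (c x) (length u + c x)) (words A′ (∑ c A′))
      ≡⟨ ∑-words-congᴬ A′ A′-ok (∑ c A′) (λ u u-ok _ → per-word u u-ok) ⟩
    ∑ (λ u → K * (𝟙 (hasContentOn A′ c u) * 𝟙 (descentFree u))) (words A′ (∑ c A′))
      ≡⟨ ∑-distribˡ-* K _ (words A′ (∑ c A′)) ⟩
    K * countFree A′ c ∎
    where
    open ≡-Reasoning
    open Insertion A x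
    A′ : List ℕ
    A′ = A ∖ x
    K : ℕ
    K = (c x + ∑ (λ y → 𝟙 (noDescent x y) * c y) A′) C c x

    Letter : ℕ → Set
    Letter y = y ∈! A′ × (y ∈! A × (y ≡ᵇ x) ≡ false) × x dominates y

    A′-ok : All Letter A′
    A′-ok = All.zipWith (λ (y∈!A′ , y≢x , y∈!A , x≽y) → y∈!A′ , (y∈!A , not≡true⇒≡false y≢x) , x≽y)
      (distinct-filterᵇ _ A A-distinct ,
       All.zipWith (λ (y≢x , y∈!A , x≽y) → y≢x , y∈!A , x≽y)
         (filterᵇ-true _ A , filter⁺ (T? ∘ λ y → not (y ≡ᵇ x)) (All.zip (A-distinct , x≽A))))

    per-word : ∀ u → All Letter u →
      𝟙 (hasContentOn A′ c u) * insertions 0 u (c x) (length u + c x) ≡ K * (𝟙 (hasContentOn A′ c u) * 𝟙 (descentFree u))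
    per-word u u-ok with hasContentOn A′ c u in u-content
    ... | false = sym (*-zeroʳ K)
    ... | true  = begin
      1 * insertions 0 u (c x) (length u + c x)
        ≡⟨ *-identityˡ _ ⟩
      insertions 0 u (c x) (length u + c x)
        ≡⟨ insertions-dominant x∈!A 0 u (c x) (inj₂ λ ())
                               (All.map (proj₁ ∘ proj₂) u-ok) (All.map (proj₂ ∘ proj₂) u-ok) ⟩
      𝟙 (descentFree (0 ∷ u)) * ((c x + freeSlots u) C c x)
        ≡⟨ cong₂ (λ b F → 𝟙 b * ((c x + F) C c x)) (descentFree-0∷ u) freeSlots≡ ⟩
      𝟙 (descentFree u) * K
        ≡⟨ trans (*-comm _ K) (cong (K *_) (sym (*-identityˡ _))) ⟩
      K * (1 * 𝟙 (descentFree u)) ∎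
      where
      freeSlots≡ : freeSlots u ≡ ∑ (λ y → 𝟙 (noDescent x y) * c y) A′
      freeSlots≡ = trans (∑-letters _ A′ u (All.map proj₁ u-ok))
        (∑-congᴬ A′ (andAll-true _ A′ u-content) (λ y y-ok → cong (𝟙 (noDescent x y) *_) (≡ᵇ-true⇒≡ y-ok)))

  countFree-bars : ∀ A → All (_∈! A) A → 0 ∈! A → ∀ c →
    countFree A c ≡
    ∑ (λ u → 𝟙 (hasContentOn (A ∖ 0) c u) * ((∑ c (A ∖ 0) + c 0 ∸ descents u) C ∑ c (A ∖ 0)))
      (words (A ∖ 0) (∑ c (A ∖ 0)))
  countFree-bars A A-distinct 0∈!A c =
    trans (countFree-by-erase A 0 A-distinct 0∈!A c)
          (∑-words-congᴬ (A ∖ 0) A′-ok (∑ c (A ∖ 0)) λ u u-ok ∣u∣ →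
             cong (𝟙 (hasContentOn (A ∖ 0) c u) *_)
               (trans (insertions-bars A 0∈!A 0 u (c 0) u-ok)
                      (cong₂ (λ M d → (M + c 0 ∸ d) C M) ∣u∣ (descents-0∷ u))))
    where
    A′-ok : All (λ y → y ∈! A × (y ≡ᵇ 0) ≡ false) (A ∖ 0)
    A′-ok = All.zipWith (λ (y≢0 , y∈!A) → y∈!A , not≡true⇒≡false y≢0)
                        (filterᵇ-true _ A , filter⁺ (T? ∘ λ y → not (y ≡ᵇ 0)) A-distinct)

  noDescent-from-nonX : ∀ {b} y → X⁺ b ≡ false → noDescent b y ≡ true
  noDescent-from-nonX {b} y b∉X rewrite b∉X = cong not (∧-zeroʳ (y <ᵇ b))

  countFree-noX : ∀ c B → All (_∈! B) B → All (λ y → X⁺ y ≡ false) B → countFree B c ≡ multinomial′ (map c B)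
  countFree-noX c []      _ _ = refl
  countFree-noX c (b ∷ B) B-distinct (b∉X ∷ B∉X) = begin
    countFree (b ∷ B) c
      ≡⟨ countFree-dominant (b ∷ B) b B-distinct (All.head B-distinct)
                            (All.map (λ y∉X → inj₂ λ y∈X → contradiction (trans (sym y∉X) y∈X) λ ()) (b∉X ∷ B∉X)) c ⟩
    ((c b + ∑ (λ y → 𝟙 (noDescent b y) * c y) ((b ∷ B) ∖ b)) C c b) * countFree ((b ∷ B) ∖ b) c
      ≡⟨ cong (λ B′ → ((c b + ∑ (λ y → 𝟙 (noDescent b y) * c y) B′) C c b) * countFree B′ c)
              (∷-∖ b B (All.head B-distinct)) ⟩
    ((c b + ∑ (λ y → 𝟙 (noDescent b y) * c y) B) C c b) * countFree B c
      ≡⟨ cong₂ (λ S n → ((c b + S) C c b) * n)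
               (trans (∑-cong B (λ y → trans (cong (λ e → 𝟙 e * c y) (noDescent-from-nonX {b} y b∉X)) (*-identityˡ (c y))))
                      (sym (foldr-map≡∑ c B)))
               (countFree-noX c B (∷-distinct b B B-distinct) B∉X) ⟩
    multinomial′ (map c (b ∷ B)) ∎
    where open ≡-Reasoning

  -- alphabet t consists of 0, …, m without the X-letters above t; removing the X-letters from the
  -- largest down, each removed letter dominates the remaining alphabet.
  module Staircase (m : ℕ) (c : ℕ → ℕ) where

    keep : ℕ → ℕ → Bool
    keep t y = not (X⁺ y ∧ (t <ᵇ y))

    alphabet : ℕ → List ℕ
    alphabet t = filterᵇ (keep t) (upFrom 0 (suc m))

    factor : ℕ → ℕ
    factor x = (c x + ∑ (λ y → 𝟙 (noDescent x y) * c y) (alphabet x ∖ x)) C c x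

    keep-≢ : ∀ t y → y ≢ suc t → keep (suc t) y ≡ keep t y
    keep-≢ t y y≢1+t = cong (λ b → not (X⁺ y ∧ b)) (<ᵇ-suc t y y≢1+t)

    alphabet-∖ : ∀ t → X⁺ (suc t) ≡ true → alphabet (suc t) ∖ suc t ≡ alphabet t
    alphabet-∖ t t∈X = trans (filterᵇ-filterᵇ (λ y → not (y ≡ᵇ suc t)) (keep (suc t)) (upFrom 0 (suc m)))
                             (filterᵇ-congᴬ (upFrom 0 (suc m)) (upFrom-bounds 0 (suc m)) (λ y _ → step y))
      where
      step : ∀ y → (keep (suc t) y ∧ not (y ≡ᵇ suc t)) ≡ keep t y
      step y with y ≡ᵇ suc t in e
      ... | false = trans (∧-identityʳ _) (keep-≢ t y (≡ᵇ-false⇒≢ e))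
      ... | true with refl ← ≡ᵇ-true⇒≡ {y} e =
        trans (∧-zeroʳ _) (sym (cong₂ (λ a b → not (a ∧ b)) t∈X (<⇒<ᵇ-true (n<1+n t))))

    alphabet-nonX : ∀ t → X⁺ (suc t) ≡ false → alphabet (suc t) ≡ alphabet t
    alphabet-nonX t t∉X = filterᵇ-congᴬ (upFrom 0 (suc m)) (upFrom-bounds 0 (suc m)) (λ y _ → step y)
      where
      step : ∀ y → keep (suc t) y ≡ keep t y
      step y with y ≡ᵇ suc t in e
      ... | false = keep-≢ t y (≡ᵇ-false⇒≢ e)
      ... | true with refl ← ≡ᵇ-true⇒≡ {y} e rewrite t∉X = refl

    alphabet-distinct : ∀ t → All (_∈! alphabet t) (alphabet t)
    alphabet-distinct t = distinct-filterᵇ (keep t) (upFrom 0 (suc m)) (upFrom-distinct 0 (suc m))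

    ∈!-alphabet : ∀ t → suc t ≤ m → suc t ∈! alphabet (suc t)
    ∈!-alphabet t 1+t≤m =
      trans (occ-filterᵇ (keep (suc t)) {suc t} (upFrom 0 (suc m)) (keep-self t))
            (upFrom-unique 0 (suc m) z≤n (s≤s 1+t≤m))
      where
      keep-self : ∀ t → keep (suc t) (suc t) ≡ true
      keep-self t = cong not (trans (cong (X⁺ (suc t) ∧_) (≮⇒<ᵇ-false {suc t} (<-irrefl refl))) (∧-zeroʳ _))

    dominates-alphabet : ∀ t → X⁺ (suc t) ≡ true → All (suc t dominates_) (alphabet (suc t))
    dominates-alphabet t t∈X = All.map dominated (filterᵇ-true (keep (suc t)) (upFrom 0 (suc m)))
      where
      dominated : ∀ {y} → keep (suc t) y ≡ true → suc t dominates y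
      dominated {y} kept with y ≡ᵇ suc t in e
      ... | true  = inj₁ (≡ᵇ-true⇒≡ e)
      ... | false = inj₂ λ y∈X → ≤∧≢⇒< (y≤1+t y∈X) (≡ᵇ-false⇒≢ e) , t∈X
        where
        y≤1+t : X⁺ y ≡ true → y ≤ suc t
        y≤1+t y∈X = ≮⇒≥ λ 1+t<y →
          contradiction (trans (sym kept) (cong₂ (λ a b → not (a ∧ b)) y∈X (<⇒<ᵇ-true 1+t<y))) λ ()

    countFree-staircase : ∀ t → t ≤ m →
      countFree (alphabet t) c ≡ countFree (alphabet 0) c * product (map factor (filterᵇ X⁺ (upFrom 1 t)))
    countFree-staircase zero    _     = sym (*-identityʳ _)
    countFree-staircase (suc t) 1+t≤m with X⁺ (suc t) in 1+t∈?X
    ... | false = begin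
      countFree (alphabet (suc t)) c
        ≡⟨ cong (λ A → countFree A c) (alphabet-nonX t 1+t∈?X) ⟩
      countFree (alphabet t) c
        ≡⟨ countFree-staircase t (<⇒≤ 1+t≤m) ⟩
      countFree (alphabet 0) c * product (map factor (filterᵇ X⁺ (upFrom 1 t)))
        ≡⟨ cong (λ xs → countFree (alphabet 0) c * product (map factor xs)) (sym X-letters) ⟩
      countFree (alphabet 0) c * product (map factor (filterᵇ X⁺ (upFrom 1 (suc t)))) ∎
      where
      open ≡-Reasoning
      X-letters : filterᵇ X⁺ (upFrom 1 (suc t)) ≡ filterᵇ X⁺ (upFrom 1 t)
      X-letters = trans (filterᵇ-upFrom-snoc X⁺ t)
                        (trans (cong (filterᵇ X⁺ (upFrom 1 t) ++_) (filterᵇ-reject X⁺ [] 1+t∈?X)) (++-identityʳ _))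
    ... | true = begin
      countFree (alphabet (suc t)) c
        ≡⟨ countFree-dominant (alphabet (suc t)) (suc t) (alphabet-distinct (suc t)) (∈!-alphabet t 1+t≤m)
                              (dominates-alphabet t 1+t∈?X) c ⟩
      factor (suc t) * countFree (alphabet (suc t) ∖ suc t) c
        ≡⟨ cong (λ A → factor (suc t) * countFree A c) (alphabet-∖ t 1+t∈?X) ⟩
      factor (suc t) * countFree (alphabet t) c
        ≡⟨ cong (factor (suc t) *_) (countFree-staircase t (<⇒≤ 1+t≤m)) ⟩
      factor (suc t) * (countFree (alphabet 0) c * product (map factor (filterᵇ X⁺ (upFrom 1 t))))
        ≡⟨ *-CS.x∙yz≈y∙zx (factor (suc t)) (countFree (alphabet 0) c) (product (map factor (filterᵇ X⁺ (upFrom 1 t)))) ⟩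
      countFree (alphabet 0) c * (product (map factor (filterᵇ X⁺ (upFrom 1 t))) * factor (suc t))
        ≡⟨ cong (λ xs → countFree (alphabet 0) c * xs) (sym X-letters) ⟩
      countFree (alphabet 0) c * product (map factor (filterᵇ X⁺ (upFrom 1 (suc t)))) ∎
      where
      open ≡-Reasoning
      X-letters : product (map factor (filterᵇ X⁺ (upFrom 1 (suc t))))
                ≡ product (map factor (filterᵇ X⁺ (upFrom 1 t))) * factor (suc t)
      X-letters = begin
        product (map factor (filterᵇ X⁺ (upFrom 1 (suc t))))
          ≡⟨ cong (product ∘ map factor) (filterᵇ-upFrom-snoc X⁺ t) ⟩
        product (map factor (Xs ++ filterᵇ X⁺ (suc t ∷ [])))
          ≡⟨ cong (λ ys → product (map factor (Xs ++ ys))) (filterᵇ-accept X⁺ [] 1+t∈?X) ⟩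
        product (map factor (Xs ++ suc t ∷ []))
          ≡⟨ cong product (map-++ factor Xs (suc t ∷ [])) ⟩
        product (map factor Xs ++ factor (suc t) ∷ [])
          ≡⟨ product-++ (map factor Xs) (factor (suc t) ∷ []) ⟩
        product (map factor Xs) * (factor (suc t) * 1)
          ≡⟨ cong (product (map factor Xs) *_) (*-identityʳ (factor (suc t))) ⟩
        product (map factor Xs) * factor (suc t) ∎
        where Xs = filterᵇ X⁺ (upFrom 1 t)

    alphabet-top : alphabet m ≡ upFrom 0 (suc m)
    alphabet-top = filterᵇ-all (keep m) (upFrom 0 (suc m))
      (All.map (λ {y} (_ , y<1+m) →
                  cong not (trans (cong (X⁺ y ∧_) (≮⇒<ᵇ-false (≤⇒≯ (s≤s⁻¹ y<1+m)))) (∧-zeroʳ (X⁺ y))))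
               (upFrom-bounds 0 (suc m)))

    alphabet-bottom-nonX : All (λ y → X⁺ y ≡ false) (alphabet 0)
    alphabet-bottom-nonX = All.map (λ {y} → nonX {y}) (filterᵇ-true (keep 0) (upFrom 0 (suc m)))
      where
      nonX : ∀ {y} → keep 0 y ≡ true → X⁺ y ≡ false
      nonX {zero}  _ = refl
      nonX {suc y} kept with X (suc y)
      ... | false = refl

    countFree-full : countFree (upFrom 0 (suc m)) c ≡
                     multinomial′ (map c (alphabet 0)) * product (map factor (filterᵇ X⁺ (upFrom 1 m)))
    countFree-full = begin
      countFree (upFrom 0 (suc m)) c
        ≡⟨ cong (λ A → countFree A c) (sym alphabet-top) ⟩
      countFree (alphabet m) c
        ≡⟨ countFree-staircase m ≤-refl ⟩
      countFree (alphabet 0) c * product (map factor (filterᵇ X⁺ (upFrom 1 m)))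
        ≡⟨ cong (_* product (map factor (filterᵇ X⁺ (upFrom 1 m))))
                (countFree-noX c (alphabet 0) (alphabet-distinct 0) alphabet-bottom-nonX) ⟩
      multinomial′ (map c (alphabet 0)) * product (map factor (filterᵇ X⁺ (upFrom 1 m))) ∎
      where open ≡-Reasoning

    factor-slots : ∀ t → suc t ≤ m → X⁺ (suc t) ≡ true →
      ∑ (λ y → 𝟙 (noDescent (suc t) y) * c y) (alphabet (suc t) ∖ suc t) ≡
      c 0 + (∑ (λ y → 𝟙 (not (Y y)) * c y) (upFrom 1 t) + ∑ (λ y → 𝟙 (not (X y)) * c y) (upFrom (2 + t) (m ∸ suc t)))
    factor-slots t 1+t≤m 1+t∈X = begin
      ∑ f (alphabet (suc t) ∖ suc t)
        ≡⟨ cong (∑ f) (alphabet-∖ t 1+t∈X) ⟩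
      ∑ f (alphabet t)
        ≡⟨ ∑-filter (T? ∘ keep t) f (upFrom 0 (suc m)) ⟩
      G 0 + ∑ G (upFrom 1 m)
        ≡⟨ cong (λ ys → G 0 + ∑ G ys) split ⟩
      G 0 + ∑ G (upFrom 1 t ++ suc t ∷ upFrom (2 + t) (m ∸ suc t))
        ≡⟨ cong (G 0 +_) (∑-++ G (upFrom 1 t) _) ⟩
      G 0 + (∑ G (upFrom 1 t) + (G (suc t) + ∑ G (upFrom (2 + t) (m ∸ suc t))))
        ≡⟨ cong₂ (λ a b → a + (b + (G (suc t) + ∑ G (upFrom (2 + t) (m ∸ suc t))))) G-bar
                 (∑-congᴬ (upFrom 1 t) (upFrom-bounds 1 t) (λ y (1≤y , y<1+t) → G-below y 1≤y y<1+t)) ⟩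
      c 0 + (∑ (λ y → 𝟙 (not (Y y)) * c y) (upFrom 1 t) + (G (suc t) + ∑ G (upFrom (2 + t) (m ∸ suc t))))
        ≡⟨ cong₂ (λ a b → c 0 + (∑ (λ y → 𝟙 (not (Y y)) * c y) (upFrom 1 t) + (a + b))) G-self
                 (∑-congᴬ (upFrom (2 + t) (m ∸ suc t)) (upFrom-bounds (2 + t) (m ∸ suc t))
                          (λ y (2+t≤y , _) → G-above y 2+t≤y)) ⟩
      c 0 + (∑ (λ y → 𝟙 (not (Y y)) * c y) (upFrom 1 t) + ∑ (λ y → 𝟙 (not (X y)) * c y) (upFrom (2 + t) (m ∸ suc t))) ∎
      where
      open ≡-Reasoning
      f : ℕ → ℕ
      f y = 𝟙 (noDescent (suc t) y) * c y
      G : ℕ → ℕ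
      G y = 𝟙 (keep t y) * f y

      split : upFrom 1 m ≡ upFrom 1 t ++ suc t ∷ upFrom (2 + t) (m ∸ suc t)
      split = trans (cong (upFrom 1) (sym (m+[n∸m]≡n (<⇒≤ 1+t≤m))))
                    (trans (upFrom-+ 1 t (m ∸ t)) (cong (λ k → upFrom 1 t ++ upFrom (suc t) k) (+-∸-assoc 1 1+t≤m)))

      G-bar : G 0 ≡ c 0
      G-bar rewrite noDescent-0 (suc t) = trans (+-identityʳ _) (+-identityʳ (c 0))

      G-below : ∀ y → 1 ≤ y → y < 1 + t → G y ≡ 𝟙 (not (Y y)) * c y
      G-below (suc y) _ y<1+t rewrite ≮⇒<ᵇ-false {t} {suc y} (≤⇒≯ (s≤s⁻¹ y<1+t)) | ∧-zeroʳ (X (suc y))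
                                    | <⇒<ᵇ-true y<1+t | 1+t∈X = +-identityʳ _

      G-self : G (suc t) ≡ 0
      G-self rewrite 1+t∈X | <⇒<ᵇ-true (n<1+n t) = refl

      G-above : ∀ y → 2 + t ≤ y → G y ≡ 𝟙 (not (X y)) * c y
      G-above (suc y) 2+t≤y rewrite <⇒<ᵇ-true {t} {suc y} (≤-trans (n≤1+n (suc t)) 2+t≤y) | ∧-identityʳ (X (suc y))
                                  | ≮⇒<ᵇ-false {suc y} {suc t} (≤⇒≯ (≤-trans (n≤1+n (suc t)) 2+t≤y))
        = cong (𝟙 (not (X (suc y))) *_) (+-identityʳ (c (suc y)))

-- Words of a composition

allWords≡words : ∀ m n → allWords m n ≡ words [ m ] n
allWords≡words m zero    = refl
allWords≡words m (suc n) = cong (λ W → concatMap (λ c → map (c ∷_) W) [ m ]) (allWords≡words m n)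

P≡∑ : ∀ X Y ρ s →
      P X Y ρ s ≡ ∑ (λ w → 𝟙 (hasContent ρ w) * 𝟙 (des X Y w ≡ᵇ s)) (words (upFrom 1 (parts ρ)) (sum ρ))
P≡∑ X Y ρ s = begin
  length (filter (λ w → des X Y w ≟ s) (R ρ))
    ≡⟨ length≡∑1 (filter (λ w → des X Y w ≟ s) (R ρ)) ⟩
  ∑ (λ _ → 1) (filter (λ w → des X Y w ≟ s) (R ρ))
    ≡⟨ ∑-filter (λ w → des X Y w ≟ s) _ (R ρ) ⟩
  ∑ (λ w → 𝟙 (des X Y w ≡ᵇ s) * 1) (R ρ)
    ≡⟨ ∑-filter (T? ∘ hasContent ρ) _ (allWords (parts ρ) (sum ρ)) ⟩
  ∑ (λ w → 𝟙 (hasContent ρ w) * (𝟙 (des X Y w ≡ᵇ s) * 1)) (allWords (parts ρ) (sum ρ))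
    ≡⟨ ∑-cong (allWords (parts ρ) (sum ρ)) (λ w → cong (𝟙 (hasContent ρ w) *_) (*-identityʳ _)) ⟩
  ∑ (λ w → 𝟙 (hasContent ρ w) * 𝟙 (des X Y w ≡ᵇ s)) (allWords (parts ρ) (sum ρ))
    ≡⟨ cong (∑ (λ w → 𝟙 (hasContent ρ w) * 𝟙 (des X Y w ≡ᵇ s)))
            (trans (allWords≡words (parts ρ) (sum ρ)) (cong (λ A → words A (sum ρ)) [ parts ρ ]≡upFrom)) ⟩
  ∑ (λ w → 𝟙 (hasContent ρ w) * 𝟙 (des X Y w ≡ᵇ s)) (words (upFrom 1 (parts ρ)) (sum ρ)) ∎
  where open ≡-Reasoning

∑-part-shift : ∀ a ρ k l → ∑ (part (a ∷ ρ)) (upFrom (2 + k) l) ≡ ∑ (part ρ) (upFrom (1 + k) l)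
∑-part-shift a ρ k zero    = refl
∑-part-shift a ρ k (suc l) = cong (part ρ (suc k) +_) (∑-part-shift a ρ (suc k) l)

∑-part : ∀ ρ → ∑ (part ρ) (upFrom 1 (parts ρ)) ≡ sum ρ
∑-part []      = refl
∑-part (a ∷ ρ) = cong (a +_) (trans (∑-part-shift a ρ 0 (parts ρ)) (∑-part ρ))

upFrom-positive : ∀ k l → All (1 ≤_) (upFrom (suc k) l)
upFrom-positive k l = All.map (λ (1+k≤y , _) → ≤-trans (s≤s z≤n) 1+k≤y) (upFrom-bounds (suc k) l)

module Composition (X Y : SubsetOfℕ) (ρ : List ℕ) where
  open DescentFree X Y

  m n : ℕ
  m = parts ρ
  n = sum ρ

  -- r bars (the letter 0) together with the letters of the composition.
  barContent : ℕ → ℕ → ℕ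
  barContent r zero    = r
  barContent r (suc y) = part ρ (suc y)

  barContent-positive : ∀ r {y} → 1 ≤ y → barContent r y ≡ part ρ y
  barContent-positive r {suc y} _ = refl

  hasContentOn-barContent : ∀ r u → hasContentOn (upFrom 1 m) (barContent r) u ≡ hasContent ρ u
  hasContentOn-barContent r u =
    trans (andAll-cong (upFrom 1 m) (upFrom-positive 0 m)
                       (λ y 1≤y → cong₂ _≡ᵇ_ (sym (count≡occ y u)) (barContent-positive r 1≤y)))
          (cong (λ L → andAll (map (λ x → count x u ≡ᵇ part ρ x) L)) (sym [ m ]≡upFrom))

  -- Each word with d descents and n letters admits (n + r ∸ d) C n placements of r bars breaking all its descents.
  barredCount : ∀ r → ∑ (λ w → 𝟙 (hasContent ρ w) * ((n + r ∸ des X Y w) C n)) (words (upFrom 1 m) n)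
                      ≡ countFree (upFrom 0 (suc m)) (barContent r)
  barredCount r = sym (begin
    countFree (upFrom 0 (suc m)) (barContent r)
      ≡⟨ countFree-bars (upFrom 0 (suc m)) (upFrom-distinct 0 (suc m)) (upFrom-unique 0 (suc m) z≤n (s≤s z≤n))
                        (barContent r) ⟩
    barSum A′ (∑ (barContent r) A′)
      ≡⟨ cong₂ barSum A′≡ (trans (cong (∑ (barContent r)) A′≡) total≡n) ⟩
    barSum (upFrom 1 m) n
      ≡⟨ ∑-words-congᴬ (upFrom 1 m) (upFrom-positive 0 m) n (λ u 1≤u _ →
           cong₂ (λ b d → 𝟙 b * ((n + r ∸ d) C n)) (hasContentOn-barContent r u) (descents≡des u 1≤u)) ⟩
    ∑ (λ w → 𝟙 (hasContent ρ w) * ((n + r ∸ des X Y w) C n)) (words (upFrom 1 m) n) ∎)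
    where
    open ≡-Reasoning
    barSum : List ℕ → ℕ → ℕ
    barSum B N = ∑ (λ u → 𝟙 (hasContentOn B (barContent r) u) * ((N + r ∸ descents u) C N)) (words B N)
    A′ : List ℕ
    A′ = upFrom 0 (suc m) ∖ 0
    A′≡ : A′ ≡ upFrom 1 m
    A′≡ = filterᵇ-all _ (upFrom 1 m) (All.map (λ { {suc y} _ → refl }) (upFrom-positive 0 m))
    total≡n : ∑ (barContent r) (upFrom 1 m) ≡ n
    total≡n = trans (∑-congᴬ (upFrom 1 m) (upFrom-positive 0 m) (λ y → barContent-positive r)) (∑-part ρ)

  vs ks : List ℕ
  vs = compl X m
  ks = map (part ρ) vs

  a : ℕ
  a = sum ks

  F : ℕ → ℕ → ℕ
  F r x = (part ρ x + r + α X ρ x + β Y ρ x) C part ρ x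

  vs-positive : All (1 ≤_) vs
  vs-positive = subst (All (1 ≤_)) (cong (filterᵇ (not ∘ X)) (sym [ m ]≡upFrom))
                      (filter⁺ (T? ∘ not ∘ X) (upFrom-positive 0 m))

  sum-part-filterᵇ : ∀ r (b : ℕ → Bool) L → All (1 ≤_) L →
                     sum (map (part ρ) (filterᵇ b L)) ≡ ∑ (λ y → 𝟙 (b y) * barContent r y) L
  sum-part-filterᵇ r b L 1≤L =
    trans (foldr-map≡∑ (part ρ) (filterᵇ b L))
          (trans (∑-filter (T? ∘ b) (part ρ) L)
                 (∑-congᴬ L 1≤L (λ y 1≤y → cong (𝟙 (b y) *_) (sym (barContent-positive r 1≤y)))))

  module _ (r : ℕ) where
    open Staircase m (barContent r)

    alphabet-bottom : alphabet 0 ≡ 0 ∷ vs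
    alphabet-bottom = cong (0 ∷_) (trans
      (filterᵇ-congᴬ (upFrom 1 m) (upFrom-positive 0 m) (λ { (suc y) _ → cong not (∧-identityʳ (X (suc y))) }))
      (cong (filterᵇ (not ∘ X)) (sym [ m ]≡upFrom)))

    multinomial-bottom : multinomial′ (map (barContent r) (alphabet 0)) ≡ ((a + r) C r) * multinomial ks
    multinomial-bottom = begin
      multinomial′ (map (barContent r) (alphabet 0))
        ≡⟨ cong (multinomial′ ∘ map (barContent r)) alphabet-bottom ⟩
      multinomial′ (r ∷ map (barContent r) vs)
        ≡⟨ cong (λ L → multinomial′ (r ∷ L)) (map-congᴬ vs vs-positive (λ y → barContent-positive r)) ⟩
      ((r + a) C r) * multinomial′ ks
        ≡⟨ cong₂ (λ k M → (k C r) * M) (+-comm r a) (sym (multinomial≡multinomial′ ks)) ⟩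
      ((a + r) C r) * multinomial ks ∎
      where open ≡-Reasoning

    factor≡F : ∀ x → X⁺ x ≡ true → 1 ≤ x → x < 1 + m → factor x ≡ F r x
    factor≡F (suc t) x∈X _ x<1+m = begin
      (p + ∑ (λ y → 𝟙 (noDescent (suc t) y) * barContent r y) (alphabet (suc t) ∖ suc t)) C p
        ≡⟨ cong (λ S → (p + S) C p) slots ⟩
      (p + (r + (α X ρ (suc t) + β Y ρ (suc t)))) C p
        ≡⟨ cong (_C p) (sym (trans (+-assoc (p + r) (α X ρ (suc t)) _) (+-assoc p r _))) ⟩
      F r (suc t) ∎
      where
      open ≡-Reasoning
      p : ℕ
      p = part ρ (suc t)
      α≡ : α X ρ (suc t) ≡ ∑ (λ y → 𝟙 (not (X y)) * barContent r y) (upFrom (2 + t) (m ∸ suc t))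
      α≡ = trans (cong (λ L → sum (map (part ρ) (filterᵇ (not ∘ X) L))) (range≡upFrom (2 + t) m x<1+m))
                 (sum-part-filterᵇ r (not ∘ X) _ (upFrom-positive (suc t) (m ∸ suc t)))
      β≡ : β Y ρ (suc t) ≡ ∑ (λ y → 𝟙 (not (Y y)) * barContent r y) (upFrom 1 t)
      β≡ = trans (cong (λ L → sum (map (part ρ) (filterᵇ (not ∘ Y) L))) [ t ]≡upFrom)
                 (sum-part-filterᵇ r (not ∘ Y) (upFrom 1 t) (upFrom-positive 0 t))
      slots : ∑ (λ y → 𝟙 (noDescent (suc t) y) * barContent r y) (alphabet (suc t) ∖ suc t)
              ≡ r + (α X ρ (suc t) + β Y ρ (suc t))
      slots = trans (factor-slots t (s≤s⁻¹ x<1+m) x∈X)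
                    (cong (r +_) (trans (cong₂ _+_ (sym β≡) (sym α≡)) (+-comm (β Y ρ (suc t)) (α X ρ (suc t)))))

    X-letters≡inter : filterᵇ X⁺ (upFrom 1 m) ≡ inter X m
    X-letters≡inter = trans (filterᵇ-congᴬ (upFrom 1 m) (upFrom-positive 0 m) (λ { (suc y) _ → refl }))
                            (cong (filterᵇ X) (sym [ m ]≡upFrom))

    product-factor : product (map factor (filterᵇ X⁺ (upFrom 1 m))) ≡ product (map (F r) (inter X m))
    product-factor = cong product (trans
      (map-congᴬ (filterᵇ X⁺ (upFrom 1 m))
                 (All.zip (filterᵇ-true X⁺ (upFrom 1 m) , filter⁺ (T? ∘ X⁺) (upFrom-bounds 1 m)))
                 (λ x (x∈X , 1≤x , x<1+m) → factor≡F x x∈X 1≤x x<1+m))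
      (cong (map (F r)) X-letters≡inter))

    countFree-closed : countFree (upFrom 0 (suc m)) (barContent r) ≡
                       ((a + r) C r) * multinomial ks * product (map (F r) (inter X m))
    countFree-closed = trans countFree-full (cong₂ _*_ multinomial-bottom product-factor)

-- Binomial inversion

open import Data.Integer as ℤ using (ℤ; +_; 0ℤ; -1ℤ)
import Data.Integer.Properties as ℤₚ
module ℤ*-CS = Algebra.Properties.CommutativeSemigroup ℤₚ.*-commutativeSemigroup
open import Data.Integer.Tactic.RingSolver using () renaming (solve-∀ to ℤ-solve-∀)

open ListSum ℤₚ.+-*-isCommutativeSemiring using ()
  renaming (∑ to ∑ℤ; ∑-cong to ∑ℤ-cong; ∑-congᴬ to ∑ℤ-congᴬ; ∑-++ to ∑ℤ-++; ∑-zero to ∑ℤ-zero;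
            ∑-distrib-+ to ∑ℤ-distrib-+; ∑-distribˡ-* to ∑ℤ-distribˡ-*; ∑-comm to ∑ℤ-comm;
            foldr-map≡∑ to foldr-map≡∑ℤ)

+-∑ : ∀ {A : Set} (f : A → ℕ) xs → + ∑ f xs ≡ ∑ℤ (λ x → + f x) xs
+-∑ f []       = refl
+-∑ f (x ∷ xs) = trans (ℤₚ.pos-+ (f x) (∑ f xs)) (cong (λ z → + f x ℤ.+ z) (+-∑ f xs))

∑≤ : ℕ → (ℕ → ℤ) → ℤ
∑≤ s f = ∑ℤ f (upFrom 0 (suc s))

Σℤ≡∑≤ : ∀ s f → Σℤ[r≤ s ] f ≡ ∑≤ s f
Σℤ≡∑≤ s f = trans (cong (foldr ℤ._+_ 0ℤ ∘ map f) (range≡upFrom 0 s z≤n)) (foldr-map≡∑ℤ f (upFrom 0 (suc s)))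

∑≤-suc : ∀ s f → ∑≤ (suc s) f ≡ ∑≤ s f ℤ.+ f (suc s)
∑≤-suc s f = trans (cong (∑ℤ f) (upFrom-snoc 0 (suc s)))
                   (trans (∑ℤ-++ f (upFrom 0 (suc s)) (suc s ∷ []))
                          (cong (λ z → ∑≤ s f ℤ.+ z) (ℤₚ.+-identityʳ (f (suc s)))))

∑≤-cong : ∀ s {f g} → (∀ r → r ≤ s → f r ≡ g r) → ∑≤ s f ≡ ∑≤ s g
∑≤-cong s f≗g = ∑ℤ-congᴬ (upFrom 0 (suc s)) (upFrom-bounds 0 (suc s)) (λ r (_ , r<1+s) → f≗g r (s≤s⁻¹ r<1+s))

binomialTransform : ℕ → (ℕ → ℤ) → ℕ → ℤ
binomialTransform K f s = ∑≤ s (λ r → sgn (s ∸ r) ℤ.* (+ (K C (s ∸ r)) ℤ.* f r))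

Δ : (ℕ → ℤ) → ℕ → ℤ
Δ g zero    = g zero
Δ g (suc s) = g (suc s) ℤ.- g s

Δ^ : ℕ → (ℕ → ℤ) → ℕ → ℤ
Δ^ zero    f = f
Δ^ (suc K) f = Δ (Δ^ K f)

Δ-cong : ∀ {f g} → (∀ s → f s ≡ g s) → ∀ s → Δ f s ≡ Δ g s
Δ-cong f≗g zero    = f≗g zero
Δ-cong f≗g (suc s) = cong₂ ℤ._-_ (f≗g (suc s)) (f≗g s)

Δ^-cong : ∀ K {f g} → (∀ s → f s ≡ g s) → ∀ s → Δ^ K f s ≡ Δ^ K g s
Δ^-cong zero    f≗g = f≗g
Δ^-cong (suc K) f≗g = Δ-cong (Δ^-cong K f≗g)

Δ^-suc : ∀ K f s → Δ^ (suc K) f s ≡ Δ^ K (Δ f) s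
Δ^-suc zero    f s = refl
Δ^-suc (suc K) f s = Δ-cong (Δ^-suc K f) s

binomialTransform-zero : ∀ f s → binomialTransform 0 f s ≡ f s
binomialTransform-zero f zero    = trans (ℤₚ.+-identityʳ _) (trans (ℤₚ.*-identityˡ _) (ℤₚ.*-identityˡ (f 0)))
binomialTransform-zero f (suc s) = begin
  binomialTransform 0 f (suc s)
    ≡⟨ ∑≤-suc s h ⟩
  ∑≤ s h ℤ.+ h (suc s)
    ≡⟨ cong₂ ℤ._+_ (trans (∑≤-cong s vanish) (∑ℤ-zero (upFrom 0 (suc s)))) last ⟩
  0ℤ ℤ.+ f (suc s)
    ≡⟨ ℤₚ.+-identityˡ (f (suc s)) ⟩
  f (suc s) ∎
  where
  open ≡-Reasoning
  h : ℕ → ℤ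
  h r = sgn (suc s ∸ r) ℤ.* (+ (0 C (suc s ∸ r)) ℤ.* f r)
  vanish : ∀ r → r ≤ s → h r ≡ 0ℤ
  vanish r r≤s rewrite +-∸-assoc 1 r≤s = ℤₚ.*-zeroʳ (sgn (suc (s ∸ r)))
  last : h (suc s) ≡ f (suc s)
  last rewrite n∸n≡0 s = trans (ℤₚ.*-identityˡ _) (ℤₚ.*-identityˡ (f (suc s)))

-- Pascal's rule turns the transform of order K + 1 into the difference of two transforms of order K.
binomialTransform-suc : ∀ K f s → binomialTransform (suc K) f s ≡ Δ (binomialTransform K f) s
binomialTransform-suc K f zero    = refl
binomialTransform-suc K f (suc s) = begin
  binomialTransform (suc K) f (suc s)
    ≡⟨ ∑≤-suc s h ⟩
  ∑≤ s h ℤ.+ h (suc s)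
    ≡⟨ cong₂ ℤ._+_ (∑≤-cong s split) (trans last (sym last₁)) ⟩
  ∑≤ s (λ r → h₁ r ℤ.+ -1ℤ ℤ.* h₂ r) ℤ.+ h₁ (suc s)
    ≡⟨ cong (λ z → z ℤ.+ h₁ (suc s)) (trans (∑ℤ-distrib-+ h₁ _ (upFrom 0 (suc s)))
                                    (cong (λ z → ∑≤ s h₁ ℤ.+ z) (∑ℤ-distribˡ-* -1ℤ h₂ (upFrom 0 (suc s))))) ⟩
  ∑≤ s h₁ ℤ.+ -1ℤ ℤ.* ∑≤ s h₂ ℤ.+ h₁ (suc s)
    ≡⟨ rearrange (∑≤ s h₁) (∑≤ s h₂) (h₁ (suc s)) ⟩
  (∑≤ s h₁ ℤ.+ h₁ (suc s)) ℤ.- ∑≤ s h₂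
    ≡⟨ cong (ℤ._- ∑≤ s h₂) (sym (∑≤-suc s h₁)) ⟩
  binomialTransform K f (suc s) ℤ.- binomialTransform K f s ∎
  where
  open ≡-Reasoning
  h h₁ h₂ : ℕ → ℤ
  h  r = sgn (suc s ∸ r) ℤ.* (+ (suc K C (suc s ∸ r)) ℤ.* f r)
  h₁ r = sgn (suc s ∸ r) ℤ.* (+ (K C (suc s ∸ r)) ℤ.* f r)
  h₂ r = sgn (s ∸ r) ℤ.* (+ (K C (s ∸ r)) ℤ.* f r)

  split : ∀ r → r ≤ s → h r ≡ h₁ r ℤ.+ -1ℤ ℤ.* h₂ r
  split r r≤s rewrite +-∸-assoc 1 r≤s =
    trans (cong (λ n → ℤ.- sgn (s ∸ r) ℤ.* (n ℤ.* f r))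
                (trans (cong +_ (sym (nCk+nC[k+1]≡[n+1]C[k+1] K (s ∸ r)))) (ℤₚ.pos-+ (K C (s ∸ r)) _)))
          (distribute (sgn (s ∸ r)) (+ (K C (s ∸ r))) (+ (K C suc (s ∸ r))) (f r))
    where
    distribute : ∀ g a b x → ℤ.- g ℤ.* ((a ℤ.+ b) ℤ.* x) ≡ ℤ.- g ℤ.* (b ℤ.* x) ℤ.+ -1ℤ ℤ.* (g ℤ.* (a ℤ.* x))
    distribute = ℤ-solve-∀

  last : h (suc s) ≡ f (suc s)
  last rewrite n∸n≡0 s = trans (ℤₚ.*-identityˡ _) (ℤₚ.*-identityˡ (f (suc s)))
  last₁ : h₁ (suc s) ≡ f (suc s)
  last₁ rewrite n∸n≡0 s = trans (ℤₚ.*-identityˡ _) (ℤₚ.*-identityˡ (f (suc s)))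

  rearrange : ∀ a b c → a ℤ.+ -1ℤ ℤ.* b ℤ.+ c ≡ (a ℤ.+ c) ℤ.- b
  rearrange = ℤ-solve-∀

binomialTransform≡Δ^ : ∀ K f s → binomialTransform K f s ≡ Δ^ K f s
binomialTransform≡Δ^ zero    f s = binomialTransform-zero f s
binomialTransform≡Δ^ (suc K) f s = trans (binomialTransform-suc K f s) (Δ-cong (binomialTransform≡Δ^ K f) s)

ramp : ℕ → ℕ → ℕ → ℤ
ramp K d r = if d ≤ᵇ r then + ((K + (r ∸ d)) C K) else 0ℤ

+-difference : ∀ {a b c} → a ≡ b + c → + a ℤ.- + b ≡ + c
+-difference {a} {b} {c} refl = trans (cong (ℤ._- + b) (ℤₚ.pos-+ b c)) (cancel (+ b) (+ c))
  where cancel : ∀ x y → x ℤ.+ y ℤ.- x ≡ y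
        cancel = ℤ-solve-∀

KC≡1 : ∀ K → (K + 0) C K ≡ 1
KC≡1 K = trans (cong (_C K) (+-identityʳ K)) (nCn≡1 K)

Δ-ramp : ∀ K d s → Δ (ramp (suc K) d) s ≡ ramp K d s
Δ-ramp K zero    zero = cong +_ (trans (KC≡1 (suc K)) (sym (KC≡1 K)))
Δ-ramp K (suc d) zero = refl
Δ-ramp K d (suc s) with <-cmp d (suc s)
... | tri< d<1+s _ _ rewrite ≤⇒≤ᵇ-true (<⇒≤ d<1+s) | ≤⇒≤ᵇ-true (s≤s⁻¹ d<1+s) | +-∸-assoc 1 (s≤s⁻¹ d<1+s) =
  +-difference (begin
    (suc K + suc j) C suc K          ≡⟨ cong (_C suc K) (+-suc (suc K) j) ⟩
    suc (suc K + j) C suc K          ≡⟨ sym (nCk+nC[k+1]≡[n+1]C[k+1] (suc K + j) K) ⟩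
    (suc K + j) C K + (suc K + j) C suc K ≡⟨ +-comm ((suc K + j) C K) _ ⟩
    (suc K + j) C suc K + (suc K + j) C K ≡⟨ cong (λ n → (suc K + j) C suc K + n C K) (sym (+-suc K j)) ⟩
    (suc K + j) C suc K + (K + suc j) C K ∎)
  where
  open ≡-Reasoning
  j : ℕ
  j = s ∸ d
... | tri≈ _ refl _ rewrite ≤⇒≤ᵇ-true (≤-refl {suc s}) | >⇒≤ᵇ-false (n<1+n s) | n∸n≡0 s =
  +-difference (trans (KC≡1 (suc K)) (sym (KC≡1 K)))
... | tri> _ _ 1+s<d rewrite >⇒≤ᵇ-false 1+s<d | >⇒≤ᵇ-false (<-trans (n<1+n s) 1+s<d) = refl

Δ-ramp-zero : ∀ d s → Δ (ramp 0 d) s ≡ + 𝟙 (d ≡ᵇ s)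
Δ-ramp-zero zero    zero = refl
Δ-ramp-zero (suc d) zero = refl
Δ-ramp-zero d (suc s) with <-cmp d (suc s)
... | tri< d<1+s d≢1+s _ rewrite ≤⇒≤ᵇ-true (<⇒≤ d<1+s) | ≤⇒≤ᵇ-true (s≤s⁻¹ d<1+s) | ≢⇒≡ᵇ-false d≢1+s =
  ℤₚ.+-inverseʳ (+ 1)
... | tri≈ _ refl _ rewrite ≤⇒≤ᵇ-true (≤-refl {suc s}) | >⇒≤ᵇ-false (n<1+n s) | ≡ᵇ-refl s = refl
... | tri> _ d≢1+s 1+s<d rewrite >⇒≤ᵇ-false 1+s<d | >⇒≤ᵇ-false (<-trans (n<1+n s) 1+s<d) | ≢⇒≡ᵇ-false d≢1+s = refl

Δ^-ramp : ∀ K d s → Δ^ (suc K) (ramp K d) s ≡ + 𝟙 (d ≡ᵇ s)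
Δ^-ramp zero    d s = Δ-ramp-zero d s
Δ^-ramp (suc K) d s = trans (Δ^-suc (suc K) (ramp (suc K) d) s) (trans (Δ^-cong (suc K) (Δ-ramp K d) s) (Δ^-ramp K d s))

C-∸≡ramp : ∀ n d r → d ≤ n → + ((n + r ∸ d) C n) ≡ ramp n d r
C-∸≡ramp n d r d≤n with d ≤? r
... | yes d≤r rewrite ≤⇒≤ᵇ-true d≤r = cong (λ k → + (k C n)) (+-∸-assoc n d≤r)
... | no  d≰r rewrite >⇒≤ᵇ-false (≰⇒> d≰r) = cong +_ (k>n⇒nCk≡0 (begin-strict
  n + r ∸ d   <⟨ ∸-monoʳ-< (≰⇒> d≰r) (≤-trans d≤n (m≤m+n n r)) ⟩
  n + r ∸ r   ≡⟨ m+n∸n≡m n r ⟩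
  n           ∎))
  where open ≤-Reasoning

binomial-inversion : ∀ n d s → d ≤ n →
  ∑≤ s (λ r → sgn (s ∸ r) ℤ.* (+ (suc n C (s ∸ r)) ℤ.* + ((n + r ∸ d) C n))) ≡ + 𝟙 (d ≡ᵇ s)
binomial-inversion n d s d≤n =
  trans (∑≤-cong s (λ r _ → cong (λ z → sgn (s ∸ r) ℤ.* (+ (suc n C (s ∸ r)) ℤ.* z)) (C-∸≡ramp n d r d≤n)))
        (trans (binomialTransform≡Δ^ (suc n) (ramp n d) s) (Δ^-ramp n d s))

∑-by-statistic : ∀ {A : Set} (h d : A → ℕ) n s xs → All (λ x → d x ≤ n) xs →
  + ∑ (λ x → h x * 𝟙 (d x ≡ᵇ s)) xs ≡
  ∑≤ s (λ r → sgn (s ∸ r) ℤ.* (+ (suc n C (s ∸ r)) ℤ.* + ∑ (λ x → h x * ((n + r ∸ d x) C n)) xs))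
∑-by-statistic {A} h d n s xs d≤n = begin
  + ∑ (λ x → h x * 𝟙 (d x ≡ᵇ s)) xs
    ≡⟨ +-∑ _ xs ⟩
  ∑ℤ (λ x → + (h x * 𝟙 (d x ≡ᵇ s))) xs
    ≡⟨ ∑ℤ-congᴬ xs d≤n (λ x dx≤n → trans (ℤₚ.pos-* (h x) _)
                                         (cong (+ h x ℤ.*_) (sym (binomial-inversion n (d x) s dx≤n)))) ⟩
  ∑ℤ (λ x → + h x ℤ.* ∑≤ s (λ r → term r x)) xs
    ≡⟨ ∑ℤ-cong xs (λ x → sym (∑ℤ-distribˡ-* (+ h x) (λ r → term r x) (upFrom 0 (suc s)))) ⟩
  ∑ℤ (λ x → ∑≤ s (λ r → + h x ℤ.* term r x)) xs
    ≡⟨ ∑ℤ-comm (λ x r → + h x ℤ.* term r x) xs (upFrom 0 (suc s)) ⟩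
  ∑≤ s (λ r → ∑ℤ (λ x → + h x ℤ.* term r x) xs)
    ≡⟨ ∑≤-cong s (λ r _ → per-r r) ⟩
  ∑≤ s (λ r → sgn (s ∸ r) ℤ.* (+ (suc n C (s ∸ r)) ℤ.* + ∑ (λ x → h x * ((n + r ∸ d x) C n)) xs)) ∎
  where
  open ≡-Reasoning
  term : ℕ → A → ℤ
  term r x = sgn (s ∸ r) ℤ.* (+ (suc n C (s ∸ r)) ℤ.* + ((n + r ∸ d x) C n))
  regroup : ∀ a g k c → a ℤ.* (g ℤ.* (k ℤ.* c)) ≡ (g ℤ.* k) ℤ.* (a ℤ.* c)
  regroup = ℤ-solve-∀
  per-r : ∀ r → ∑ℤ (λ x → + h x ℤ.* term r x) xs ≡
          sgn (s ∸ r) ℤ.* (+ (suc n C (s ∸ r)) ℤ.* + ∑ (λ x → h x * ((n + r ∸ d x) C n)) xs)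
  per-r r = begin
    ∑ℤ (λ x → + h x ℤ.* term r x) xs
      ≡⟨ ∑ℤ-cong xs (λ x → trans (regroup (+ h x) (sgn (s ∸ r)) (+ (suc n C (s ∸ r))) (+ ((n + r ∸ d x) C n)))
                                 (cong (sgn (s ∸ r) ℤ.* + (suc n C (s ∸ r)) ℤ.*_) (sym (ℤₚ.pos-* (h x) _)))) ⟩
    ∑ℤ (λ x → (sgn (s ∸ r) ℤ.* + (suc n C (s ∸ r))) ℤ.* + (h x * ((n + r ∸ d x) C n))) xs
      ≡⟨ ∑ℤ-distribˡ-* (sgn (s ∸ r) ℤ.* + (suc n C (s ∸ r))) _ xs ⟩
    (sgn (s ∸ r) ℤ.* + (suc n C (s ∸ r))) ℤ.* ∑ℤ (λ x → + (h x * ((n + r ∸ d x) C n))) xs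
      ≡⟨ cong ((sgn (s ∸ r) ℤ.* + (suc n C (s ∸ r))) ℤ.*_) (sym (+-∑ _ xs)) ⟩
    (sgn (s ∸ r) ℤ.* + (suc n C (s ∸ r))) ℤ.* + ∑ (λ x → h x * ((n + r ∸ d x) C n)) xs
      ≡⟨ ℤₚ.*-assoc (sgn (s ∸ r)) _ _ ⟩
    sgn (s ∸ r) ℤ.* (+ (suc n C (s ∸ r)) ℤ.* + ∑ (λ x → h x * ((n + r ∸ d x) C n)) xs) ∎

∑≤-extract : ∀ s (c p q : ℕ → ℕ) M →
  ∑≤ s (λ r → sgn (s ∸ r) ℤ.* (+ c r ℤ.* + (p r * M * q r))) ≡
  + M ℤ.* ∑≤ s (λ r → sgn (s ∸ r) ℤ.* + (p r * c r * q r))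
∑≤-extract s c p q M =
  trans (∑ℤ-cong (upFrom 0 (suc s)) per-term) (∑ℤ-distribˡ-* (+ M) _ (upFrom 0 (suc s)))
  where
  per-term : ∀ r → sgn (s ∸ r) ℤ.* (+ c r ℤ.* + (p r * M * q r)) ≡ + M ℤ.* (sgn (s ∸ r) ℤ.* + (p r * c r * q r))
  per-term r = begin
    sgn (s ∸ r) ℤ.* (+ c r ℤ.* + (p r * M * q r))   ≡⟨ cong (sgn (s ∸ r) ℤ.*_) (sym (ℤₚ.pos-* (c r) _)) ⟩
    sgn (s ∸ r) ℤ.* + (c r * (p r * M * q r))       ≡⟨ cong (λ k → sgn (s ∸ r) ℤ.* + k) (regroup (c r) (p r) M (q r)) ⟩
    sgn (s ∸ r) ℤ.* + (M * (p r * c r * q r))       ≡⟨ cong (sgn (s ∸ r) ℤ.*_) (ℤₚ.pos-* M _) ⟩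
    sgn (s ∸ r) ℤ.* (+ M ℤ.* + (p r * c r * q r))   ≡⟨ ℤ*-CS.x∙yz≈y∙xz (sgn (s ∸ r)) (+ M) (+ (p r * c r * q r)) ⟩
    + M ℤ.* (sgn (s ∸ r) ℤ.* + (p r * c r * q r))   ∎
    where
    open ≡-Reasoning
    regroup : ∀ c p M q → c * (p * M * q) ≡ M * (p * c * q)
    regroup = solve-∀

theorem5p1 : (X Y : SubsetOfℕ) (ρ : List ℕ) (n : ℕ) → IsComposition ρ n →
    (s : ℕ) → + P X Y ρ s ≡ RHS X Y ρ n s
theorem5p1 X Y ρ .(sum ρ) (_ , refl) s = begin
  + P X Y ρ s
    ≡⟨ cong +_ (P≡∑ X Y ρ s) ⟩
  + ∑ (λ w → 𝟙 (hasContent ρ w) * 𝟙 (des X Y w ≡ᵇ s)) W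
    ≡⟨ ∑-by-statistic (𝟙 ∘ hasContent ρ) (des X Y) n s W des≤n ⟩
  ∑≤ s (λ r → sgn (s ∸ r) ℤ.* (+ (suc n C (s ∸ r)) ℤ.* + ∑ (λ w → 𝟙 (hasContent ρ w) * ((n + r ∸ des X Y w) C n)) W))
    ≡⟨ ∑≤-cong s (λ r _ → cong (λ k → sgn (s ∸ r) ℤ.* (+ (suc n C (s ∸ r)) ℤ.* + k))
                                 (trans (barredCount r) (countFree-closed r))) ⟩
  ∑≤ s (λ r → sgn (s ∸ r) ℤ.* (+ (suc n C (s ∸ r)) ℤ.* + (((a + r) C r) * multinomial ks * Π r)))
    ≡⟨ ∑≤-extract s (λ r → suc n C (s ∸ r)) (λ r → (a + r) C r) Π (multinomial ks) ⟩
  + multinomial ks ℤ.* ∑≤ s (λ r → sgn (s ∸ r) ℤ.* + (((a + r) C r) * (suc n C (s ∸ r)) * Π r))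
    ≡⟨ cong (λ z → + multinomial ks ℤ.* z)
            (sym (Σℤ≡∑≤ s (λ r → sgn (s ∸ r) ℤ.* + (((a + r) C r) * (suc n C (s ∸ r)) * Π r)))) ⟩
  RHS X Y ρ n s ∎
  where
  open ≡-Reasoning
  open Composition X Y ρ
  W : List (List ℕ)
  W = words (upFrom 1 m) n
  Π : ℕ → ℕ
  Π r = product (map (F r) (inter X m))
  des≤n : All (λ w → des X Y w ≤ n) W
  des≤n = All.map (λ {w} ∣w∣≡n → ≤-trans (des-≤-length X Y w) (≤-reflexive ∣w∣≡n)) (words-length (upFrom 1 m) n)
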